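{- For all positive integers $m,k$ we have $L(m)=1=R(m)$ and $R(m,k)=1+k$. For $n\ge2$ and positive integers $m_1,\dots,m_n$, $$L(m_1,m_2,\dots,m_n)=\sum_{j_2=0}^{m_2}\binom{m_1}{m_2-j_2}L(m_1+j_2,m_3,\dots,m_n),$$ and $$R(m_1,m_2,\dots,m_n)=R(m_2,\dots,m_n)+\sum_{(j_3,\dots,j_n)\in\{0,1\}^{n-2}} m_2\prod_{a=3}^{n}\binom{m_a+1+j_3+\cdots+j_{a-1}}{m_a-j_a}.$$
   Context: $\mathcal{A}_n=\{1<\cdots<n\}$. A composition diagram is a finite left-to-right sequence of nonempty bottom-justified columns of boxes; the bottom row consists of the lowest boxes. An lps tableau over $\mathcal{A}_n$: filling by elements of $\mathcal{A}_n$ with columns strictly increasing bottom to top and bottom row weakly increasing left to right. An rps tableau: columns weakly increasing bottom to top and bottom row strictly increasing left to right. $L(m_1,\dots,m_n)$ (resp. $R(m_1,\dots,m_n)$) is the number of lps (resp. rps) tableaux over $\mathcal{A}_n$ in which each symbol $a$ occurs exactly $m_a$ times (for shorter sequences, over the corresponding $\mathcal{A}_{n'}$). Convention: $\binom{m}{k}=0$ for $k>m$; empty products equal $1$ (so for $n=2$ the sum in the second formula has a single term equal to $m_2$). -}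

module Defs where

open import Data.Nat using (ℕ; zero; suc; _+_; _*_; _∸_)
open import Data.Nat.Combinatorics using (_C_)
open import Data.Fin using (Fin; _<_; _≤_; _≟_)
open import Data.List using (List; []; _∷_; length; map; filter; concatMap; tabulate; upTo)
open import Data.Nat.ListAction using (sum)
open import Data.List.NonEmpty using (List⁺; head; toList)
open import Data.List.Relation.Unary.All using (All)
open import Data.List.Relation.Unary.Linked using (Linked)
open import Data.Product using (Σ; _×_)
open import Relation.Binary.PropositionalEquality using (_≡_)

-- A filling of a composition diagram by symbols of A_n = Fin n:
-- a left-to-right list of nonempty columns, each column listed bottom to top.
Filling : ℕ → Set
Filling n = List (List⁺ (Fin n))

bottomRow : ∀ {n} → Filling n → List (Fin n)
bottomRow = map head

entries : ∀ {n} → Filling n → List (Fin n)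
entries = concatMap toList

occ : ∀ {n} → Fin n → Filling n → ℕ
occ a t = length (filter (a ≟_) (entries t))

IsLps : ∀ {n} → Filling n → Set
IsLps t = All (λ c → Linked _<_ (toList c)) t × Linked _≤_ (bottomRow t)

IsRps : ∀ {n} → Filling n → Set
IsRps t = All (λ c → Linked _≤_ (toList c)) t × Linked _<_ (bottomRow t)

HasContent : (ms : List ℕ) → Filling (length ms) → Set
HasContent ms t = tabulate (λ a → occ a t) ≡ ms

LpsTab : List ℕ → Set
LpsTab ms = Σ (Filling (length ms)) (λ t → IsLps t × HasContent ms t)

RpsTab : List ℕ → Set
RpsTab ms = Σ (Filling (length ms)) (λ t → IsRps t × HasContent ms t)

Positive : List ℕ → Set
Positive ms = All (λ m → 0 Data.Nat.< m) ms

bits : ℕ → List (List ℕ)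
bits zero = [] ∷ []
bits (suc k) = concatMap (λ js → (0 ∷ js) ∷ (1 ∷ js) ∷ []) (bits k)

-- prodR s (m_3,...,m_n) (j_3,...,j_n) with s = j_3+...+j_{a-1} accumulated:
--   prod_{a=3}^{n} binom(m_a + 1 + j_3 + ... + j_{a-1}, m_a - j_a)
prodR : ℕ → List ℕ → List ℕ → ℕ
prodR s (m ∷ ms) (j ∷ js) = ((m + 1 + s) C (m ∸ j)) * prodR (s + j) ms js
prodR s _ _ = 1

sumL : ℕ → ℕ → (ℕ → ℕ) → ℕ
sumL m₁ m₂ f = sum (map (λ j → (m₁ C (m₂ ∸ j)) * f j) (upTo (suc m₂)))

sumR : ℕ → List ℕ → ℕ
sumR m₂ rest = sum (map (λ js → m₂ * prodR 0 rest js) (bits (length rest)))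

-- Read a tableau from its least symbol upwards.  Deleting every symbol below b
-- leaves a partial filling: the untouched closed columns together with p open
-- columns, the remnants of columns whose bottom cell was deleted.  Deleting the
-- next symbol b, with multiplicity m, is a bijection onto simpler data.  For lps
-- fillings each open column loses at most one b, and the j closed columns with
-- bottom b become open, so the count obeys L_p(m, ms) = Σ_j C(p, m - j) L_(p+j)(ms).
-- For rps fillings each open column loses a block of b's, a weak composition of m,
-- and at most the first closed column has bottom b and becomes open, so
-- R_p(m, ms) = W(p, m) R_p(ms) + W⁺(p, m) R_(p+1)(ms) with W, W⁺ counting
-- (head-positive) weak compositions, which are binomial coefficients.  Starting
-- from p = 0 and unfolding two steps gives the stated recursions.

module Submission where

open import Defs
open import Axiom.UniquenessOfIdentityProofs using (module Decidable⇒UIP)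
open import Data.Bool using (Bool; true; false)
open import Data.Empty using (⊥; ⊥-elim)
open import Data.Fin as Fin using (Fin; toℕ; fromℕ<)
open import Data.Fin.Properties using (+↔⊎; *↔×; 1↔⊤; toℕ<n; toℕ-injective; toℕ-fromℕ<; fromℕ<-toℕ)
open import Data.List
  using (List; []; _∷_; length; map; filter; concat; concatMap; tabulate; _++_; take; drop; replicate; zipWith; upTo)
open import Data.List.NonEmpty as List⁺ using (List⁺; _∷_; toList)
open import Data.List.Properties
  using (length-++; length-map; length-take; length-drop; length-replicate; map-++; map-cong; map-applyUpTo;
         filter-++; filter-accept; filter-reject; concat-++; take++drop≡id; ∷-injective; ≡-dec)
open import Data.List.Relation.Unary.All as All using (All; []; _∷_)
open import Data.List.Relation.Unary.All.Properties using (++⁺; take⁺; drop⁺; replicate⁺)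
open import Data.List.Relation.Unary.Linked as Linked using (Linked; []; [-]; _∷_)
open import Data.Nat using (ℕ; zero; suc; _+_; _*_; _∸_; _⊓_; _≤_; _<_; _≟_; z≤n; s≤s)
open import Data.Nat.Combinatorics using (_C_; nCn≡1; nCk≡nC[n∸k]; nCk+nC[k+1]≡[n+1]C[k+1])
open import Data.Nat.ListAction using (sum)
open import Data.Nat.Properties
open import Data.Product using (Σ; _×_; _,_; proj₁; proj₂; map₁)
open import Data.Product.Function.NonDependent.Propositional using (_×-↔_)
open import Data.Sum using (_⊎_; inj₁; inj₂)
open import Data.Sum.Function.Propositional using (_⊎-↔_)
open import Data.Unit using (⊤; tt)
open import Data.Unit.Properties using (⊤-irrelevant)
open import Function using (id; _∘_; _∘′_)
open import Function.Bundles using (_↔_; mk↔ₛ′)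
open import Function.Properties.Inverse using (↔-sym; ↔-refl; ↔-trans)
open import Function.Related.Propositional using (module EquationalReasoning; bijection)
open import Relation.Binary.PropositionalEquality
open import Relation.Nullary using (¬_; Irrelevant; yes; no)

open EquationalReasoning {k = bijection} using (step-↔-⟩)
  renaming (begin_ to ↔-begin_; _∎ to _↔-∎)
open ≡-Reasoning

-- Bijections with finite types

×-irrelevant : {A B : Set} → Irrelevant A → Irrelevant B → Irrelevant (A × B)
×-irrelevant irrA irrB (a , b) (a′ , b′) = cong₂ _,_ (irrA a a′) (irrB b b′)

Σ-≡-irrelevant : {A : Set} {P : A → Set} → (∀ x → Irrelevant (P x)) →
  {x y : A} {p : P x} {q : P y} → x ≡ y → (x , p) ≡ (y , q)
Σ-≡-irrelevant irr {x} {p = p} {q} refl = cong (x ,_) (irr x p q)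

subtype-↔ : {X Y : Set} {P : X → Set} {Q : Y → Set} →
  (∀ x → Irrelevant (P x)) → (∀ y → Irrelevant (Q y)) →
  (f : ∀ x → P x → Y) (g : ∀ y → Q y → X) →
  (f-valid : ∀ x p → Q (f x p)) (g-valid : ∀ y q → P (g y q)) →
  (∀ x p q → g (f x p) q ≡ x) → (∀ y q p → f (g y q) p ≡ y) →
  Σ X P ↔ Σ Y Q
subtype-↔ irrP irrQ f g f-valid g-valid gf fg = mk↔ₛ′
  (λ (x , p) → f x p , f-valid x p) (λ (y , q) → g y q , g-valid y q)
  (λ (y , q) → Σ-≡-irrelevant irrQ (fg y q (g-valid y q)))
  (λ (x , p) → Σ-≡-irrelevant irrP (gf x p (f-valid x p)))

empty↔Fin0 : {A : Set} → ¬ A → A ↔ Fin 0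
empty↔Fin0 ¬a = mk↔ₛ′ (λ a → ⊥-elim (¬a a)) (λ ()) (λ ()) (λ a → ⊥-elim (¬a a))

≡⇒Fin↔ : {m n : ℕ} → m ≡ n → Fin m ↔ Fin n
≡⇒Fin↔ refl = ↔-refl

⊎↔Fin+ : {A B : Set} {m n : ℕ} → A ↔ Fin m → B ↔ Fin n → (A ⊎ B) ↔ Fin (m + n)
⊎↔Fin+ f g = ↔-begin _ ↔⟨ f ⊎-↔ g ⟩ _ ↔⟨ ↔-sym +↔⊎ ⟩ _ ↔-∎

×↔Fin* : {A B : Set} {m n : ℕ} → A ↔ Fin m → B ↔ Fin n → (A × B) ↔ Fin (m * n)
×↔Fin* f g = ↔-begin _ ↔⟨ f ×-↔ g ⟩ _ ↔⟨ ↔-sym *↔× ⟩ _ ↔-∎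

nC0≡1 : ∀ n → n C 0 ≡ 1
nC0≡1 n = trans (nCk≡nC[n∸k] {0} {n} z≤n) (nCn≡1 n)

∑≤ : ℕ → (ℕ → ℕ) → ℕ
∑≤ m h = sum (map h (upTo (suc m)))

∑≤-suc : ∀ m h → ∑≤ (suc m) h ≡ h 0 + ∑≤ m (h ∘ suc)
∑≤-suc m h = cong (h 0 +_) (cong sum
  (trans (map-applyUpTo suc h (suc m)) (sym (map-applyUpTo id (h ∘ suc) (suc m)))))

∑≤-cong : ∀ m {h h′ : ℕ → ℕ} → (∀ j → h j ≡ h′ j) → ∑≤ m h ≡ ∑≤ m h′
∑≤-cong m eq = cong sum (map-cong eq (upTo (suc m)))

Σ≤↔∑≤ : ∀ m (F : ℕ → Set) (h : ℕ → ℕ) → (∀ j → F j ↔ Fin (h j)) →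
  Σ (Σ ℕ (_≤ m)) (F ∘ proj₁) ↔ Fin (∑≤ m h)
Σ≤↔∑≤ zero F h F↔ = ↔-begin
  Σ (Σ ℕ (_≤ 0)) (F ∘ proj₁)  ↔⟨ only ⟩
  F 0                         ↔⟨ F↔ 0 ⟩
  Fin (h 0)                   ↔⟨ ≡⇒Fin↔ (sym (+-identityʳ (h 0))) ⟩
  Fin (∑≤ 0 h)                ↔-∎
  where
  only : Σ (Σ ℕ (_≤ 0)) (F ∘ proj₁) ↔ F 0
  only = mk↔ₛ′ (λ { ((0 , z≤n) , x) → x }) ((0 , z≤n) ,_) (λ _ → refl) (λ { ((0 , z≤n) , x) → refl })
Σ≤↔∑≤ (suc m) F h F↔ = ↔-begin
  Σ (Σ ℕ (_≤ suc m)) (F ∘ proj₁)                 ↔⟨ split ⟩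
  (F 0 ⊎ Σ (Σ ℕ (_≤ m)) (F ∘ suc ∘ proj₁))        ↔⟨ ⊎↔Fin+ (F↔ 0) (Σ≤↔∑≤ m (F ∘ suc) (h ∘ suc) (F↔ ∘ suc)) ⟩
  Fin (h 0 + ∑≤ m (h ∘ suc))                      ↔⟨ ≡⇒Fin↔ (sym (∑≤-suc m h)) ⟩
  Fin (∑≤ (suc m) h)                              ↔-∎
  where
  split : Σ (Σ ℕ (_≤ suc m)) (F ∘ proj₁) ↔ (F 0 ⊎ Σ (Σ ℕ (_≤ m)) (F ∘ suc ∘ proj₁))
  split = mk↔ₛ′
    (λ { ((0 , _) , x) → inj₁ x ; ((suc j , s≤s j≤m) , x) → inj₂ ((j , j≤m) , x) })
    (λ { (inj₁ x) → (0 , z≤n) , x ; (inj₂ ((j , j≤m) , x)) → (suc j , s≤s j≤m) , x })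
    (λ { (inj₁ x) → refl ; (inj₂ _) → refl })
    (λ { ((0 , z≤n) , x) → refl ; ((suc j , s≤s _) , x) → refl })

take-++-length : ∀ {A : Set} (xs ys : List A) → take (length xs) (xs ++ ys) ≡ xs
take-++-length [] ys = refl
take-++-length (x ∷ xs) ys = cong (x ∷_) (take-++-length xs ys)

drop-++-length : ∀ {A : Set} (xs ys : List A) → drop (length xs) (xs ++ ys) ≡ ys
drop-++-length [] ys = refl
drop-++-length (x ∷ xs) ys = drop-++-length xs ys

length-drop-+ : ∀ {A : Set} {p} j (xs : List A) → length xs ≡ j + p → length (drop j xs) ≡ p
length-drop-+ {p = p} j xs eq = trans (length-drop j xs) (trans (cong (_∸ j) eq) (m+n∸m≡n j p))

-- Bit vectors and weak compositions

countTrue : List Bool → ℕ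
countTrue [] = 0
countTrue (true ∷ bs) = suc (countTrue bs)
countTrue (false ∷ bs) = countTrue bs

HasOnes : ℕ → ℕ → List Bool → Set
HasOnes p k bs = length bs ≡ p × countTrue bs ≡ k

BitVec : ℕ → ℕ → Set
BitVec p k = Σ (List Bool) (HasOnes p k)

HasOnes-irrelevant : ∀ p k bs → Irrelevant (HasOnes p k bs)
HasOnes-irrelevant p k bs = ×-irrelevant ≡-irrelevant ≡-irrelevant

BitVec↔C : ∀ p k → BitVec p k ↔ Fin (p C k)
BitVec↔C zero zero = ↔-begin
  BitVec 0 0  ↔⟨ mk↔ₛ′ _ (λ _ → [] , refl , refl) (λ _ → refl) (λ { ([] , refl , refl) → refl }) ⟩
  ⊤           ↔⟨ ↔-sym 1↔⊤ ⟩
  Fin 1       ↔-∎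
BitVec↔C zero (suc k) = empty↔Fin0 λ { ([] , _ , ()) }
BitVec↔C (suc p) zero = ↔-begin
  BitVec (suc p) 0  ↔⟨ tail↔ ⟩
  BitVec p 0        ↔⟨ BitVec↔C p 0 ⟩
  Fin (p C 0)       ↔⟨ ≡⇒Fin↔ (trans (nC0≡1 p) (sym (nC0≡1 (suc p)))) ⟩
  Fin (suc p C 0)   ↔-∎
  where
  tail↔ : BitVec (suc p) 0 ↔ BitVec p 0
  tail↔ = mk↔ₛ′
    (λ { ((false ∷ bs) , l , t) → bs , suc-injective l , t ; ((true ∷ _) , _ , ()) })
    (λ (bs , l , t) → (false ∷ bs) , cong suc l , t)
    (λ (bs , _) → Σ-≡-irrelevant (HasOnes-irrelevant p 0) refl)
    (λ { ((false ∷ bs) , _) → Σ-≡-irrelevant (HasOnes-irrelevant (suc p) 0) refl ; ((true ∷ _) , _ , ()) })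
BitVec↔C (suc p) (suc k) = ↔-begin
  BitVec (suc p) (suc k)             ↔⟨ head↔ ⟩
  (BitVec p (suc k) ⊎ BitVec p k)    ↔⟨ ⊎↔Fin+ (BitVec↔C p (suc k)) (BitVec↔C p k) ⟩
  Fin (p C suc k + p C k)            ↔⟨ ≡⇒Fin↔ (trans (+-comm (p C suc k) (p C k)) (nCk+nC[k+1]≡[n+1]C[k+1] p k)) ⟩
  Fin (suc p C suc k)                ↔-∎
  where
  head↔ : BitVec (suc p) (suc k) ↔ (BitVec p (suc k) ⊎ BitVec p k)
  head↔ = mk↔ₛ′
    (λ { ((false ∷ bs) , l , t) → inj₁ (bs , suc-injective l , t)
       ; ((true ∷ bs) , l , t) → inj₂ (bs , suc-injective l , suc-injective t) })
    (λ { (inj₁ (bs , l , t)) → (false ∷ bs) , cong suc l , t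
       ; (inj₂ (bs , l , t)) → (true ∷ bs) , cong suc l , cong suc t })
    (λ { (inj₁ _) → cong inj₁ (Σ-≡-irrelevant (HasOnes-irrelevant p (suc k)) refl)
       ; (inj₂ _) → cong inj₂ (Σ-≡-irrelevant (HasOnes-irrelevant p k) refl) })
    (λ { ((false ∷ _) , _) → Σ-≡-irrelevant (HasOnes-irrelevant (suc p) (suc k)) refl
       ; ((true ∷ _) , _) → Σ-≡-irrelevant (HasOnes-irrelevant (suc p) (suc k)) refl })

IsComposition : ℕ → ℕ → List ℕ → Set
IsComposition k m cs = length cs ≡ k × sum cs ≡ m

Composition : ℕ → ℕ → Set
Composition k m = Σ (List ℕ) (IsComposition k m)

IsComposition-irrelevant : ∀ k m cs → Irrelevant (IsComposition k m cs)
IsComposition-irrelevant k m cs = ×-irrelevant ≡-irrelevant ≡-irrelevant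

compositions : ℕ → ℕ → ℕ
compositions zero zero = 1
compositions zero (suc m) = 0
compositions (suc k) zero = compositions k zero
compositions (suc k) (suc m) = compositions k (suc m) + compositions (suc k) m

Composition↔compositions : ∀ k m → Composition k m ↔ Fin (compositions k m)
Composition↔compositions zero zero = ↔-begin
  Composition 0 0  ↔⟨ mk↔ₛ′ _ (λ _ → [] , refl , refl) (λ _ → refl) (λ { ([] , refl , refl) → refl }) ⟩
  ⊤                ↔⟨ ↔-sym 1↔⊤ ⟩
  Fin 1            ↔-∎
Composition↔compositions zero (suc m) = empty↔Fin0 λ { ([] , _ , ()) }
Composition↔compositions (suc k) zero = ↔-begin
  Composition (suc k) 0  ↔⟨ tail↔ ⟩
  Composition k 0        ↔⟨ Composition↔compositions k 0 ⟩
  Fin (compositions k 0) ↔-∎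
  where
  tail↔ : Composition (suc k) 0 ↔ Composition k 0
  tail↔ = mk↔ₛ′
    (λ { ((zero ∷ cs) , l , s) → cs , suc-injective l , s ; ((suc _ ∷ _) , _ , ()) })
    (λ (cs , l , s) → (0 ∷ cs) , cong suc l , s)
    (λ _ → Σ-≡-irrelevant (IsComposition-irrelevant k 0) refl)
    (λ { ((zero ∷ _) , _) → Σ-≡-irrelevant (IsComposition-irrelevant (suc k) 0) refl ; ((suc _ ∷ _) , _ , ()) })
Composition↔compositions (suc k) (suc m) = ↔-begin
  Composition (suc k) (suc m)                          ↔⟨ head↔ ⟩
  (Composition k (suc m) ⊎ Composition (suc k) m)      ↔⟨ ⊎↔Fin+ (Composition↔compositions k (suc m)) (Composition↔compositions (suc k) m) ⟩
  Fin (compositions (suc k) (suc m))                   ↔-∎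
  where
  head↔ : Composition (suc k) (suc m) ↔ (Composition k (suc m) ⊎ Composition (suc k) m)
  head↔ = mk↔ₛ′
    (λ { ((zero ∷ cs) , l , s) → inj₁ (cs , suc-injective l , s)
       ; ((suc c ∷ cs) , l , s) → inj₂ ((c ∷ cs) , l , suc-injective s) })
    (λ { (inj₁ (cs , l , s)) → (0 ∷ cs) , cong suc l , s
       ; (inj₂ ((c ∷ cs) , l , s)) → (suc c ∷ cs) , l , cong suc s })
    (λ { (inj₁ _) → cong inj₁ (Σ-≡-irrelevant (IsComposition-irrelevant k (suc m)) refl)
       ; (inj₂ ((_ ∷ _) , _)) → cong inj₂ (Σ-≡-irrelevant (IsComposition-irrelevant (suc k) m) refl) })
    (λ { ((zero ∷ _) , _) → Σ-≡-irrelevant (IsComposition-irrelevant (suc k) (suc m)) refl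
       ; ((suc _ ∷ _) , _) → Σ-≡-irrelevant (IsComposition-irrelevant (suc k) (suc m)) refl })

HeadPositive : List ℕ → Set
HeadPositive [] = ⊥
HeadPositive (c ∷ _) = 1 ≤ c

IsPositiveComposition : ℕ → ℕ → List ℕ → Set
IsPositiveComposition k m cs = IsComposition (suc k) m cs × HeadPositive cs

PositiveComposition : ℕ → ℕ → Set
PositiveComposition k m = Σ (List ℕ) (IsPositiveComposition k m)

IsPositiveComposition-irrelevant : ∀ k m cs → Irrelevant (IsPositiveComposition k m cs)
IsPositiveComposition-irrelevant k m [] = λ { (_ , ()) }
IsPositiveComposition-irrelevant k m (c ∷ cs) =
  ×-irrelevant (IsComposition-irrelevant (suc k) m (c ∷ cs)) ≤-irrelevant

positiveCompositions : ℕ → ℕ → ℕ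
positiveCompositions k zero = 0
positiveCompositions k (suc m) = compositions (suc k) m

PositiveComposition↔positiveCompositions : ∀ k m →
  PositiveComposition k m ↔ Fin (positiveCompositions k m)
PositiveComposition↔positiveCompositions k zero =
  empty↔Fin0 λ { ((zero ∷ _) , _ , ()) ; ((suc _ ∷ _) , (_ , ()) , _) }
PositiveComposition↔positiveCompositions k (suc m) = ↔-begin
  PositiveComposition k (suc m)  ↔⟨ decrement-head ⟩
  Composition (suc k) m          ↔⟨ Composition↔compositions (suc k) m ⟩
  Fin (compositions (suc k) m)   ↔-∎
  where
  decrement-head : PositiveComposition k (suc m) ↔ Composition (suc k) m
  decrement-head = mk↔ₛ′
    (λ { ((zero ∷ _) , _ , ()) ; ((suc c ∷ cs) , (l , s) , _) → (c ∷ cs) , l , suc-injective s })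
    (λ { ((c ∷ cs) , l , s) → (suc c ∷ cs) , (l , cong suc s) , s≤s z≤n })
    (λ { ((_ ∷ _) , _) → Σ-≡-irrelevant (IsComposition-irrelevant (suc k) m) refl })
    (λ { ((zero ∷ _) , _ , ()) ; ((suc _ ∷ _) , _) → Σ-≡-irrelevant (IsPositiveComposition-irrelevant k (suc m)) refl })

compositions[k,0]≡1 : ∀ k → compositions k 0 ≡ 1
compositions[k,0]≡1 zero = refl
compositions[k,0]≡1 (suc k) = compositions[k,0]≡1 k

compositions[1,m]≡1 : ∀ m → compositions 1 m ≡ 1
compositions[1,m]≡1 zero = refl
compositions[1,m]≡1 (suc m) = compositions[1,m]≡1 m

compositions[1+k,m]≡[m+k]Cm : ∀ k m → compositions (suc k) m ≡ (m + k) C m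
compositions[1+k,m]≡[m+k]Cm zero m = begin
  compositions 1 m  ≡⟨ compositions[1,m]≡1 m ⟩
  1                 ≡⟨ sym (nCn≡1 m) ⟩
  m C m             ≡⟨ cong (_C m) (sym (+-identityʳ m)) ⟩
  (m + 0) C m       ∎
compositions[1+k,m]≡[m+k]Cm (suc k) zero = trans (compositions[k,0]≡1 k) (sym (nC0≡1 k))
compositions[1+k,m]≡[m+k]Cm (suc k) (suc m) = begin
  compositions (suc k) (suc m) + compositions (suc (suc k)) m
    ≡⟨ cong₂ _+_ (compositions[1+k,m]≡[m+k]Cm k (suc m)) (compositions[1+k,m]≡[m+k]Cm (suc k) m) ⟩
  (suc m + k) C suc m + (m + suc k) C m
    ≡⟨ cong (λ n → n C suc m + (m + suc k) C m) (sym (+-suc m k)) ⟩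
  (m + suc k) C suc m + (m + suc k) C m
    ≡⟨ +-comm ((m + suc k) C suc m) _ ⟩
  (m + suc k) C m + (m + suc k) C suc m
    ≡⟨ nCk+nC[k+1]≡[n+1]C[k+1] (m + suc k) m ⟩
  suc (m + suc k) C suc m ∎

compositions[2,m]≡1+m : ∀ m → compositions 2 m ≡ suc m
compositions[2,m]≡1+m zero = refl
compositions[2,m]≡1+m (suc m) = cong₂ _+_ (compositions[1,m]≡1 (suc m)) (compositions[2,m]≡1+m m)

positiveCompositions[1,m]≡m : ∀ m → positiveCompositions 1 m ≡ m
positiveCompositions[1,m]≡m zero = refl
positiveCompositions[1,m]≡m (suc m) = compositions[2,m]≡1+m m

-- Fillings by natural numbers

mult : ℕ → List ℕ → ℕ
mult x l = length (filter (x ≟_) l)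

mult-here : ∀ x l → mult x (x ∷ l) ≡ suc (mult x l)
mult-here x l = cong length (filter-accept (x ≟_) refl)

mult-there : ∀ {x y} l → x ≢ y → mult x (y ∷ l) ≡ mult x l
mult-there {x} l x≢y = cong length (filter-reject (x ≟_) x≢y)

mult-++ : ∀ x l l′ → mult x (l ++ l′) ≡ mult x l + mult x l′
mult-++ x l l′ = trans (cong length (filter-++ (x ≟_) l l′)) (length-++ (filter (x ≟_) l))

-- Symbols are naturals below T.  The entries of a list satisfying Chain g b T lie
-- in [b, T) and each exceeds its predecessor by at least g, so g = 1 means strictly
-- and g = 0 weakly increasing; in Columns gc gr b T the columns are gc-chains and
-- the bottom row is a gr-chain.
Chain : ℕ → ℕ → ℕ → List ℕ → Set
Chain g b T [] = ⊤
Chain g b T (x ∷ xs) = b ≤ x × x < T × Chain g (g + x) T xs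

Columns : ℕ → ℕ → ℕ → ℕ → List (List⁺ ℕ) → Set
Columns gc gr b T [] = ⊤
Columns gc gr b T (c ∷ cs) = Chain gc b T (toList c) × Columns gc gr (gr + List⁺.head c) T cs

Chain-irrelevant : ∀ g b T l → Irrelevant (Chain g b T l)
Chain-irrelevant g b T [] = ⊤-irrelevant
Chain-irrelevant g b T (x ∷ xs) =
  ×-irrelevant ≤-irrelevant (×-irrelevant ≤-irrelevant (Chain-irrelevant g (g + x) T xs))

Columns-irrelevant : ∀ gc gr b T cs → Irrelevant (Columns gc gr b T cs)
Columns-irrelevant gc gr b T [] = ⊤-irrelevant
Columns-irrelevant gc gr b T (c ∷ cs) =
  ×-irrelevant (Chain-irrelevant gc b T (toList c)) (Columns-irrelevant gc gr _ T cs)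

Chain-weaken : ∀ {g b′ b T} l → b′ ≤ b → Chain g b T l → Chain g b′ T l
Chain-weaken [] _ _ = tt
Chain-weaken (x ∷ xs) b′≤b (b≤x , rest) = ≤-trans b′≤b b≤x , rest

Columns-weaken : ∀ {gc gr b′ b T} cs → b′ ≤ b → Columns gc gr b T cs → Columns gc gr b′ T cs
Columns-weaken [] _ _ = tt
Columns-weaken (c ∷ cs) b′≤b (chain , rest) = Chain-weaken (toList c) b′≤b chain , rest

mult-Chain-below : ∀ {g b T y} l → y < b → Chain g b T l → mult y l ≡ 0
mult-Chain-below [] _ _ = refl
mult-Chain-below {g} {y = y} (x ∷ xs) y<b (b≤x , _ , rest) = begin
  mult y (x ∷ xs) ≡⟨ mult-there xs (<⇒≢ (<-≤-trans y<b b≤x)) ⟩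
  mult y xs       ≡⟨ mult-Chain-below xs (<-≤-trans y<b (≤-trans b≤x (m≤n+m x g))) rest ⟩
  0               ∎

mult-Columns-below : ∀ {gc gr b T y} cs → y < b → Columns gc gr b T cs → mult y (concatMap toList cs) ≡ 0
mult-Columns-below [] _ _ = refl
mult-Columns-below {gr = gr} {y = y} ((x ∷ xs) ∷ cs) y<b (chain@(b≤x , _) , rest) = begin
  mult y ((x ∷ xs) ++ concatMap toList cs)          ≡⟨ mult-++ y (x ∷ xs) _ ⟩
  mult y (x ∷ xs) + mult y (concatMap toList cs)    ≡⟨ cong₂ _+_ (mult-Chain-below (x ∷ xs) y<b chain)
                                                        (mult-Columns-below cs (<-≤-trans y<b (≤-trans b≤x (m≤n+m x gr))) rest) ⟩
  0                                                 ∎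

Chain-empty : ∀ {g b} l → Chain g b b l → l ≡ []
Chain-empty [] _ = refl
Chain-empty (x ∷ _) (b≤x , x<b , _) = ⊥-elim (<-irrefl refl (<-≤-trans x<b b≤x))

Columns-empty : ∀ {gc gr b} cs → Columns gc gr b b cs → cs ≡ []
Columns-empty [] _ = refl
Columns-empty ((x ∷ _) ∷ _) ((b≤x , x<b , _) , _) = ⊥-elim (<-irrefl refl (<-≤-trans x<b b≤x))

-- Open columns (listed bottom to top, possibly empty) and closed columns.  An
-- element of Partial gc gr T b p ms has p open columns, entries in [b, T), and
-- symbol b + i occurring ms[i] times; all uses have T = b + length ms.
PartialFilling : Set
PartialFilling = List (List ℕ) × List (List⁺ ℕ)

entriesᴾ : PartialFilling → List ℕ
entriesᴾ (ps , cs) = concat ps ++ concatMap toList cs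

HasCountsFrom : ℕ → List ℕ → (ℕ → ℕ) → Set
HasCountsFrom b [] f = ⊤
HasCountsFrom b (m ∷ ms) f = f b ≡ m × HasCountsFrom (suc b) ms f

HasCountsFrom-irrelevant : ∀ b ms f → Irrelevant (HasCountsFrom b ms f)
HasCountsFrom-irrelevant b [] f = ⊤-irrelevant
HasCountsFrom-irrelevant b (m ∷ ms) f = ×-irrelevant ≡-irrelevant (HasCountsFrom-irrelevant (suc b) ms f)

HasCountsFrom-cong : ∀ b ms {f f′ : ℕ → ℕ} → (∀ x → b ≤ x → f x ≡ f′ x) →
  HasCountsFrom b ms f → HasCountsFrom b ms f′
HasCountsFrom-cong b [] eq _ = tt
HasCountsFrom-cong b (m ∷ ms) eq (fb≡m , rest) =
  trans (sym (eq b ≤-refl)) fb≡m , HasCountsFrom-cong (suc b) ms (λ x b<x → eq x (<⇒≤ b<x)) rest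

IsPartial : ℕ → ℕ → ℕ → ℕ → ℕ → List ℕ → PartialFilling → Set
IsPartial gc gr T b p ms (ps , cs) =
  length ps ≡ p × All (Chain gc b T) ps × Columns gc gr b T cs ×
  HasCountsFrom b ms (λ x → mult x (entriesᴾ (ps , cs)))

Partial : ℕ → ℕ → ℕ → ℕ → ℕ → List ℕ → Set
Partial gc gr T b p ms = Σ PartialFilling (IsPartial gc gr T b p ms)

IsPartial-irrelevant : ∀ gc gr T b p ms o → Irrelevant (IsPartial gc gr T b p ms o)
IsPartial-irrelevant gc gr T b p ms (ps , cs) =
  ×-irrelevant ≡-irrelevant (×-irrelevant (All.irrelevant (Chain-irrelevant gc b T _))
    (×-irrelevant (Columns-irrelevant gc gr b T cs) (HasCountsFrom-irrelevant b ms _)))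

Partial-exhausted↔Fin1 : ∀ gc gr b p → Partial gc gr b b p [] ↔ Fin 1
Partial-exhausted↔Fin1 gc gr b p = ↔-begin
  Partial gc gr b b p []  ↔⟨ mk↔ₛ′ _ (λ _ → (replicate p [] , []) , valid) (λ _ → refl) unique ⟩
  ⊤                       ↔⟨ ↔-sym 1↔⊤ ⟩
  Fin 1                   ↔-∎
  where
  valid : IsPartial gc gr b b p [] (replicate p [] , [])
  valid = length-replicate p , replicate⁺ p tt , tt , tt
  empties : ∀ p ps → length ps ≡ p → All (Chain gc b b) ps → replicate p [] ≡ ps
  empties zero [] _ _ = refl
  empties (suc p) (l ∷ ps) eq (chain ∷ chains) =
    cong₂ _∷_ (sym (Chain-empty l chain)) (empties p ps (suc-injective eq) chains)
  unique : ∀ (o : Partial gc gr b b p []) → ((replicate p [] , []) , valid) ≡ o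
  unique ((ps , cs) , lp , sp , sc , _) = Σ-≡-irrelevant (IsPartial-irrelevant gc gr b b p [])
    (cong₂ _,_ (empties p ps lp sp) (sym (Columns-empty cs sc)))

-- IsLps and IsRps are definitionally IsTableau 1 0 and IsTableau 0 1.
Gap : ∀ {n} → ℕ → Fin n → Fin n → Set
Gap g x y = g + toℕ x ≤ toℕ y

IsTableau : ∀ {n} → ℕ → ℕ → Filling n → Set
IsTableau gc gr t = All (λ c → Linked (Gap gc) (toList c)) t × Linked (Gap gr) (bottomRow t)

Tableau : ℕ → ℕ → List ℕ → Set
Tableau gc gr ms = Σ (Filling (length ms)) (λ t → IsTableau gc gr t × HasContent ms t)

Above : ∀ {n} → ℕ → List (Fin n) → Set
Above c [] = ⊤
Above c (x ∷ _) = c ≤ toℕ x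

Linked-∷ : ∀ {n g} {x : Fin n} xs → Above (g + toℕ x) xs → Linked (Gap g) xs → Linked (Gap g) (x ∷ xs)
Linked-∷ [] _ _ = [-]
Linked-∷ (_ ∷ _) gap linked = gap ∷ linked

Linked-above : ∀ {n g} {x : Fin n} xs → Linked (Gap g) (x ∷ xs) → Above (g + toℕ x) xs
Linked-above [] _ = tt
Linked-above (_ ∷ _) (gap ∷ _) = gap

Chain⇒Linked : ∀ {n} g c (l : List (Fin n)) → Chain g c n (map toℕ l) → Linked (Gap g) l × Above c l
Chain⇒Linked g c [] _ = [] , tt
Chain⇒Linked g c (x ∷ xs) (c≤x , _ , rest) =
  let linked , above = Chain⇒Linked g (g + toℕ x) xs rest in Linked-∷ xs above linked , c≤x

Linked⇒Chain : ∀ {n} g c (l : List (Fin n)) → Linked (Gap g) l → Above c l → Chain g c n (map toℕ l)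
Linked⇒Chain g c [] _ _ = tt
Linked⇒Chain g c (x ∷ xs) linked c≤x =
  c≤x , toℕ<n x , Linked⇒Chain g (g + toℕ x) xs (Linked.tail linked) (Linked-above xs linked)

toℕs : ∀ {n} → Filling n → List (List⁺ ℕ)
toℕs = map (List⁺.map toℕ)

Columns⇒IsTableau : ∀ {n} gc gr c (t : Filling n) → Columns gc gr c n (toℕs t) → IsTableau gc gr t × Above c (bottomRow t)
Columns⇒IsTableau gc gr c [] _ = ([] , []) , tt
Columns⇒IsTableau gc gr c ((x ∷ xs) ∷ t) (chain , rest) =
  let column , above = Chain⇒Linked gc c (x ∷ xs) chain
      (columns , row) , rowAbove = Columns⇒IsTableau gc gr (gr + toℕ x) t rest
  in (column ∷ columns , Linked-∷ (bottomRow t) rowAbove row) , above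

IsTableau⇒Columns : ∀ {n} gc gr c (t : Filling n) → IsTableau gc gr t → Above c (bottomRow t) → Columns gc gr c n (toℕs t)
IsTableau⇒Columns gc gr c [] _ _ = tt
IsTableau⇒Columns gc gr c ((x ∷ xs) ∷ t) (column ∷ columns , row) c≤x =
  Linked⇒Chain gc c (x ∷ xs) column c≤x ,
  IsTableau⇒Columns gc gr (gr + toℕ x) t (columns , Linked.tail row) (Linked-above (bottomRow t) row)

fromChain : ∀ {g c n} (xs : List ℕ) → Chain g c n xs → List (Fin n)
fromChain [] _ = []
fromChain (x ∷ xs) (_ , x<n , rest) = fromℕ< x<n ∷ fromChain xs rest

fromColumns : ∀ {gc gr c n} (cs : List (List⁺ ℕ)) → Columns gc gr c n cs → Filling n
fromColumns [] _ = []
fromColumns ((x ∷ xs) ∷ cs) ((_ , x<n , chain) , rest) = (fromℕ< x<n ∷ fromChain xs chain) ∷ fromColumns cs rest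

toℕ-fromChain : ∀ {g c n} xs (chain : Chain g c n xs) → map toℕ (fromChain xs chain) ≡ xs
toℕ-fromChain [] _ = refl
toℕ-fromChain (x ∷ xs) (_ , x<n , rest) = cong₂ _∷_ (toℕ-fromℕ< x<n) (toℕ-fromChain xs rest)

toℕs-fromColumns : ∀ {gc gr c n} cs (columns : Columns gc gr c n cs) → toℕs (fromColumns cs columns) ≡ cs
toℕs-fromColumns [] _ = refl
toℕs-fromColumns ((x ∷ xs) ∷ cs) ((_ , x<n , chain) , rest) =
  cong₂ _∷_ (cong₂ _∷_ (toℕ-fromℕ< x<n) (toℕ-fromChain xs chain)) (toℕs-fromColumns cs rest)

fromChain-toℕ : ∀ {g c n} (l : List (Fin n)) (chain : Chain g c n (map toℕ l)) → fromChain (map toℕ l) chain ≡ l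
fromChain-toℕ [] _ = refl
fromChain-toℕ (x ∷ l) (_ , x<n , rest) = cong₂ _∷_ (fromℕ<-toℕ x x<n) (fromChain-toℕ l rest)

fromColumns-toℕs : ∀ {gc gr c n} (t : Filling n) (columns : Columns gc gr c n (toℕs t)) → fromColumns (toℕs t) columns ≡ t
fromColumns-toℕs [] _ = refl
fromColumns-toℕs ((x ∷ xs) ∷ t) ((_ , x<n , chain) , rest) =
  cong₂ _∷_ (cong₂ _∷_ (fromℕ<-toℕ x x<n) (fromChain-toℕ xs chain)) (fromColumns-toℕs t rest)

occ≡mult : ∀ {n} (a : Fin n) (t : Filling n) → occ a t ≡ mult (toℕ a) (concatMap toList (toℕs t))
occ≡mult a t = trans (filter-toℕ (entries t)) (cong (mult (toℕ a)) (entries-toℕs t))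
  where
  filter-toℕ : ∀ l → length (filter (a Fin.≟_) l) ≡ mult (toℕ a) (map toℕ l)
  filter-toℕ [] = refl
  filter-toℕ (x ∷ l) with a Fin.≟ x
  ... | yes refl = sym (trans (mult-here (toℕ a) (map toℕ l)) (cong suc (sym (filter-toℕ l))))
  ... | no a≢x = trans (filter-toℕ l) (sym (mult-there (map toℕ l) (a≢x ∘′ toℕ-injective)))
  entries-toℕs : ∀ t → map toℕ (entries t) ≡ concatMap toList (toℕs t)
  entries-toℕs [] = refl
  entries-toℕs (c ∷ t) = trans (map-++ toℕ (toList c) (entries t)) (cong (map toℕ (toList c) ++_) (entries-toℕs t))

tabulate≡⇔HasCountsFrom : ∀ b (ms : List ℕ) (f : Fin (length ms) → ℕ) (g : ℕ → ℕ) →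
  (∀ a → f a ≡ g (b + toℕ a)) →
  (tabulate f ≡ ms → HasCountsFrom b ms g) × (HasCountsFrom b ms g → tabulate f ≡ ms)
tabulate≡⇔HasCountsFrom b [] f g eq = (λ _ → tt) , (λ _ → refl)
tabulate≡⇔HasCountsFrom b (m ∷ ms) f g eq =
  (λ tab≡ → let head≡ , tail≡ = ∷-injective tab≡ in trans (sym at-b) head≡ , proj₁ rest tail≡) ,
  (λ (gb≡m , counts) → cong₂ _∷_ (trans at-b gb≡m) (proj₂ rest counts))
  where
  at-b : f Fin.zero ≡ g b
  at-b = trans (eq Fin.zero) (cong g (+-identityʳ b))
  rest : (tabulate (f ∘ Fin.suc) ≡ ms → HasCountsFrom (suc b) ms g) ×
         (HasCountsFrom (suc b) ms g → tabulate (f ∘ Fin.suc) ≡ ms)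
  rest = tabulate≡⇔HasCountsFrom (suc b) ms (f ∘ Fin.suc) g (λ a → trans (eq (Fin.suc a)) (cong g (+-suc b (toℕ a))))

HasContent⇔HasCountsFrom : ∀ ms (t : Filling (length ms)) →
  (HasContent ms t → HasCountsFrom 0 ms (λ x → mult x (entriesᴾ ([] , toℕs t)))) ×
  (HasCountsFrom 0 ms (λ x → mult x (entriesᴾ ([] , toℕs t))) → HasContent ms t)
HasContent⇔HasCountsFrom ms t = tabulate≡⇔HasCountsFrom 0 ms (λ a → occ a t) _ (λ a → occ≡mult a t)

IsTableau-irrelevant : ∀ {n} gc gr (t : Filling n) → Irrelevant (IsTableau gc gr t)
IsTableau-irrelevant gc gr t =
  ×-irrelevant (All.irrelevant (Linked.irrelevant ≤-irrelevant)) (Linked.irrelevant ≤-irrelevant)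

bottomRow-above-0 : ∀ {n} (t : Filling n) → Above 0 (bottomRow t)
bottomRow-above-0 [] = tt
bottomRow-above-0 (_ ∷ _) = z≤n

Tableau↔Partial : ∀ gc gr ms → Tableau gc gr ms ↔ Partial gc gr (length ms) 0 0 ms
Tableau↔Partial gc gr ms = subtype-↔
  (λ t → ×-irrelevant (IsTableau-irrelevant gc gr t) (Decidable⇒UIP.≡-irrelevant (≡-dec _≟_)))
  (IsPartial-irrelevant gc gr n 0 0 ms)
  (λ t _ → [] , toℕs t)
  (λ (_ , cs) (_ , _ , columns , _) → fromColumns cs columns)
  (λ t (tableau , content) → refl , [] , IsTableau⇒Columns gc gr 0 t tableau (bottomRow-above-0 t) ,
                             proj₁ (HasContent⇔HasCountsFrom ms t) content)
  (λ (ps , cs) (ps≡[] , _ , columns , counts) → valid ps cs ps≡[] columns counts)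
  (λ t _ (_ , _ , columns , _) → fromColumns-toℕs t columns)
  (λ { ([] , cs) (_ , _ , columns , _) _ → cong ([] ,_) (toℕs-fromColumns cs columns) })
  where
  n = length ms
  valid : ∀ ps cs → length ps ≡ 0 → (columns : Columns gc gr 0 n cs) →
    HasCountsFrom 0 ms (λ x → mult x (entriesᴾ (ps , cs))) →
    IsTableau gc gr (fromColumns cs columns) × HasContent ms (fromColumns cs columns)
  valid [] cs _ columns counts =
    proj₁ (Columns⇒IsTableau gc gr 0 t (subst (Columns gc gr 0 n) (sym cs≡) columns)) ,
    proj₂ (HasContent⇔HasCountsFrom ms t)
      (subst (λ cs → HasCountsFrom 0 ms (λ x → mult x (entriesᴾ ([] , cs)))) (sym cs≡) counts)
    where
    t = fromColumns cs columns
    cs≡ : toℕs t ≡ cs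
    cs≡ = toℕs-fromColumns cs columns

-- Removing the least symbol from an lps filling

peel : ℕ → List ℕ → Bool × List ℕ
peel b [] = false , []
peel b (x ∷ xs) with x ≟ b
... | yes _ = true , xs
... | no _ = false , x ∷ xs

unpeel : ℕ → Bool → List ℕ → List ℕ
unpeel b true l = b ∷ l
unpeel b false l = l

peelAll : ℕ → List (List ℕ) → List Bool × List (List ℕ)
peelAll b ps = map (proj₁ ∘ peel b) ps , map (proj₂ ∘ peel b) ps

unpeelAll : ℕ → List Bool → List (List ℕ) → List (List ℕ)
unpeelAll b = zipWith (unpeel b)

promote : ℕ → List (List⁺ ℕ) → List (List ℕ) × List (List⁺ ℕ)
promote b [] = [] , []
promote b ((x ∷ xs) ∷ cs) with x ≟ b
... | yes _ = map₁ (xs ∷_) (promote b cs)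
... | no _ = [] , (x ∷ xs) ∷ cs

demote : ℕ → List (List ℕ) → List (List⁺ ℕ) → List (List⁺ ℕ)
demote b ts cs = map (b ∷_) ts ++ cs

unpeel-peel : ∀ b l → unpeel b (proj₁ (peel b l)) (proj₂ (peel b l)) ≡ l
unpeel-peel b [] = refl
unpeel-peel b (x ∷ xs) with x ≟ b
... | yes refl = refl
... | no _ = refl

unpeelAll-peelAll : ∀ b ps → unpeelAll b (proj₁ (peelAll b ps)) (proj₂ (peelAll b ps)) ≡ ps
unpeelAll-peelAll b [] = refl
unpeelAll-peelAll b (l ∷ ps) = cong₂ _∷_ (unpeel-peel b l) (unpeelAll-peelAll b ps)

length-unpeelAll : ∀ b bs ps → length bs ≡ length ps → length (unpeelAll b bs ps) ≡ length bs
length-unpeelAll b [] [] _ = refl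
length-unpeelAll b (_ ∷ bs) (_ ∷ ps) eq = cong suc (length-unpeelAll b bs ps (suc-injective eq))

demote-promote : ∀ b cs → demote b (proj₁ (promote b cs)) (proj₂ (promote b cs)) ≡ cs
demote-promote b [] = refl
demote-promote b ((x ∷ xs) ∷ cs) with x ≟ b
... | yes refl = cong ((b ∷ xs) ∷_) (demote-promote b cs)
... | no _ = refl

mult-peel-other : ∀ {y b} → y ≢ b → ∀ l → mult y l ≡ mult y (proj₂ (peel b l))
mult-peel-other y≢b [] = refl
mult-peel-other {b = b} y≢b (x ∷ xs) with x ≟ b
... | yes refl = mult-there xs y≢b
... | no _ = refl

mult-peelAll-other : ∀ {y b} → y ≢ b → ∀ ps → mult y (concat ps) ≡ mult y (concat (proj₂ (peelAll b ps)))
mult-peelAll-other y≢b [] = refl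
mult-peelAll-other {y} {b} y≢b (l ∷ ps) = begin
  mult y (l ++ concat ps)                                                ≡⟨ mult-++ y l (concat ps) ⟩
  mult y l + mult y (concat ps)                                          ≡⟨ cong₂ _+_ (mult-peel-other y≢b l) (mult-peelAll-other y≢b ps) ⟩
  mult y (proj₂ (peel b l)) + mult y (concat (proj₂ (peelAll b ps)))     ≡⟨ mult-++ y (proj₂ (peel b l)) _ ⟨
  mult y (concat (proj₂ (peelAll b (l ∷ ps))))                           ∎

mult-promote-other : ∀ {y b} → y ≢ b → ∀ cs → mult y (concatMap toList cs) ≡
  mult y (concat (proj₁ (promote b cs))) + mult y (concatMap toList (proj₂ (promote b cs)))
mult-promote-other y≢b [] = refl
mult-promote-other {y} {b} y≢b ((x ∷ xs) ∷ cs) with x ≟ b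
... | yes refl = begin
  mult y ((b ∷ xs) ++ concatMap toList cs)                           ≡⟨ mult-there (xs ++ concatMap toList cs) y≢b ⟩
  mult y (xs ++ concatMap toList cs)                                 ≡⟨ mult-++ y xs _ ⟩
  mult y xs + mult y (concatMap toList cs)                           ≡⟨ cong (mult y xs +_) (mult-promote-other y≢b cs) ⟩
  mult y xs + (mult y (concat ts) + mult y (concatMap toList rest))  ≡⟨ +-assoc (mult y xs) _ _ ⟨
  (mult y xs + mult y (concat ts)) + mult y (concatMap toList rest)  ≡⟨ cong (_+ mult y (concatMap toList rest)) (mult-++ y xs (concat ts)) ⟨
  mult y (xs ++ concat ts) + mult y (concatMap toList rest)          ∎
  where
  ts = proj₁ (promote b cs)
  rest = proj₂ (promote b cs)
... | no _ = refl

module _ {T b : ℕ} where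

  peel-unpeel : ∀ t l → Chain 1 (suc b) T l → peel b (unpeel b t l) ≡ (t , l)
  peel-unpeel true l _ rewrite ≟-diag (refl {x = b}) = refl
  peel-unpeel false [] _ = refl
  peel-unpeel false (x ∷ xs) (b<x , _) with x ≟ b
  ... | yes refl = ⊥-elim (<-irrefl refl b<x)
  ... | no _ = refl

  peelAll-unpeelAll : ∀ bs ps → length bs ≡ length ps → All (Chain 1 (suc b) T) ps →
    peelAll b (unpeelAll b bs ps) ≡ (bs , ps)
  peelAll-unpeelAll [] [] _ _ = refl
  peelAll-unpeelAll (t ∷ bs) (l ∷ ps) eq (chain ∷ chains) =
    cong₂ (λ (t , l) (bs , ps) → t ∷ bs , l ∷ ps)
      (peel-unpeel t l chain) (peelAll-unpeelAll bs ps (suc-injective eq) chains)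

  peel-Chain : ∀ l → Chain 1 b T l → Chain 1 (suc b) T (proj₂ (peel b l))
  peel-Chain [] _ = tt
  peel-Chain (x ∷ xs) (b≤x , x<T , rest) with x ≟ b
  ... | yes refl = rest
  ... | no x≢b = ≤∧≢⇒< b≤x (≢-sym x≢b) , x<T , rest

  peelAll-Chain : ∀ {ps} → All (Chain 1 b T) ps → All (Chain 1 (suc b) T) (proj₂ (peelAll b ps))
  peelAll-Chain [] = []
  peelAll-Chain {l ∷ _} (chain ∷ chains) = peel-Chain l chain ∷ peelAll-Chain chains

  unpeel-Chain : b < T → ∀ t l → Chain 1 (suc b) T l → Chain 1 b T (unpeel b t l)
  unpeel-Chain b<T true l chain = ≤-refl , b<T , chain
  unpeel-Chain b<T false l chain = Chain-weaken l (n≤1+n b) chain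

  unpeelAll-Chain : b < T → ∀ bs {ps} → All (Chain 1 (suc b) T) ps → All (Chain 1 b T) (unpeelAll b bs ps)
  unpeelAll-Chain b<T [] _ = []
  unpeelAll-Chain b<T (_ ∷ _) [] = []
  unpeelAll-Chain b<T (t ∷ bs) {l ∷ _} (chain ∷ chains) = unpeel-Chain b<T t l chain ∷ unpeelAll-Chain b<T bs chains

  mult-peel : ∀ l → Chain 1 b T l → mult b l ≡ countTrue (proj₁ (peel b l) ∷ [])
  mult-peel [] _ = refl
  mult-peel (x ∷ xs) (b≤x , x<T , rest) with x ≟ b
  ... | yes refl = trans (mult-here b xs) (cong suc (mult-Chain-below xs ≤-refl rest))
  ... | no x≢b = mult-Chain-below (x ∷ xs) ≤-refl (≤∧≢⇒< b≤x (≢-sym x≢b) , x<T , rest)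

  mult-peelAll : ∀ ps → All (Chain 1 b T) ps → mult b (concat ps) ≡ countTrue (proj₁ (peelAll b ps))
  mult-peelAll [] [] = refl
  mult-peelAll (l ∷ ps) (chain ∷ chains) = begin
    mult b (l ++ concat ps)                                               ≡⟨ mult-++ b l (concat ps) ⟩
    mult b l + mult b (concat ps)                                         ≡⟨ cong₂ _+_ (mult-peel l chain) (mult-peelAll ps chains) ⟩
    countTrue (proj₁ (peel b l) ∷ []) + countTrue (proj₁ (peelAll b ps))  ≡⟨ countTrue-∷ (proj₁ (peel b l)) ⟩
    countTrue (proj₁ (peelAll b (l ∷ ps)))                                ∎
    where
    countTrue-∷ : ∀ t {bs} → countTrue (t ∷ []) + countTrue bs ≡ countTrue (t ∷ bs)
    countTrue-∷ true = refl
    countTrue-∷ false = refl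

  promote-demote : ∀ ts cs → Columns 1 0 (suc b) T cs → promote b (demote b ts cs) ≡ (ts , cs)
  promote-demote (t ∷ ts) cs columns rewrite ≟-diag (refl {x = b}) =
    cong (map₁ (t ∷_)) (promote-demote ts cs columns)
  promote-demote [] [] _ = refl
  promote-demote [] ((x ∷ xs) ∷ cs) ((b<x , _) , _) with x ≟ b
  ... | yes refl = ⊥-elim (<-irrefl refl b<x)
  ... | no _ = refl

  promote-valid : ∀ cs → Columns 1 0 b T cs →
    All (Chain 1 (suc b) T) (proj₁ (promote b cs)) × Columns 1 0 (suc b) T (proj₂ (promote b cs))
  promote-valid [] _ = [] , tt
  promote-valid ((x ∷ xs) ∷ cs) ((b≤x , x<T , chain) , rest) with x ≟ b
  ... | yes refl = map₁ (chain ∷_) (promote-valid cs rest)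
  ... | no x≢b = [] , (≤∧≢⇒< b≤x (≢-sym x≢b) , x<T , chain) , rest

  demote-valid : b < T → ∀ {ts cs} → All (Chain 1 (suc b) T) ts → Columns 1 0 (suc b) T cs →
    Columns 1 0 b T (demote b ts cs)
  demote-valid b<T {cs = cs} [] columns = Columns-weaken cs (n≤1+n b) columns
  demote-valid b<T (chain ∷ chains) columns = (≤-refl , b<T , chain) , demote-valid b<T chains columns

  mult-promote : ∀ cs → Columns 1 0 b T cs → mult b (concatMap toList cs) ≡ length (proj₁ (promote b cs))
  mult-promote [] _ = refl
  mult-promote ((x ∷ xs) ∷ cs) ((b≤x , x<T , chain) , rest) with x ≟ b
  ... | yes refl = begin
    mult b ((b ∷ xs) ++ concatMap toList cs)         ≡⟨ mult-here b (xs ++ concatMap toList cs) ⟩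
    suc (mult b (xs ++ concatMap toList cs))         ≡⟨ cong suc (mult-++ b xs _) ⟩
    suc (mult b xs + mult b (concatMap toList cs))   ≡⟨ cong₂ (λ u v → suc (u + v)) (mult-Chain-below xs ≤-refl chain) (mult-promote cs rest) ⟩
    suc (length (proj₁ (promote b cs)))              ∎
  ... | no x≢b = mult-Columns-below ((x ∷ xs) ∷ cs) ≤-refl ((≤∧≢⇒< b≤x (≢-sym x≢b) , x<T , chain) , rest)

-- The least symbol b of an lps partial filling occurs at most once in each open
-- column, at its bottom, and the closed columns with bottom b form a prefix.
LpsStep : Set
LpsStep = ℕ × List Bool × PartialFilling

IsLpsStep : ℕ → ℕ → ℕ → ℕ → List ℕ → LpsStep → Set
IsLpsStep T b p m ms (j , bs , o) = j ≤ m × HasOnes p (m ∸ j) bs × IsPartial 1 0 T (suc b) (j + p) ms o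

assembleᴸ : List (List ℕ) × List (List⁺ ℕ) → List Bool × List (List ℕ) → LpsStep
assembleᴸ (ts , cs) (bs , ps) = length ts , bs , (ts ++ ps , cs)

removeMinᴸ : ℕ → PartialFilling → LpsStep
removeMinᴸ b (ps , cs) = assembleᴸ (promote b cs) (peelAll b ps)

insertMinᴸ : ℕ → LpsStep → PartialFilling
insertMinᴸ b (j , bs , (ps , cs)) = unpeelAll b bs (drop j ps) , demote b (take j ps) cs

insertMinᴸ-removeMinᴸ : ∀ b o → insertMinᴸ b (removeMinᴸ b o) ≡ o
insertMinᴸ-removeMinᴸ b (ps , cs) = cong₂ _,_
  (trans (cong (unpeelAll b _) (drop-++-length ts _)) (unpeelAll-peelAll b ps))
  (trans (cong (λ ts → demote b ts _) (take-++-length ts _)) (demote-promote b cs))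
  where ts = proj₁ (promote b cs)

mult-removeMinᴸ-other : ∀ {y} b → y ≢ b → ∀ o →
  mult y (entriesᴾ o) ≡ mult y (entriesᴾ (proj₂ (proj₂ (removeMinᴸ b o))))
mult-removeMinᴸ-other {y} b y≢b (ps , cs) = begin
  mult y (concat ps ++ concatMap toList cs)        ≡⟨ mult-++ y (concat ps) _ ⟩
  mult y (concat ps) + mult y (concatMap toList cs) ≡⟨ cong₂ _+_ (mult-peelAll-other y≢b ps) (mult-promote-other y≢b cs) ⟩
  a + (t + r)                                      ≡⟨ +-assoc a t r ⟨
  (a + t) + r                                      ≡⟨ cong (_+ r) (+-comm a t) ⟩
  (t + a) + r                                      ≡⟨ cong (_+ r) (mult-++ y (concat ts) _) ⟨
  mult y (concat ts ++ concat ps′) + r             ≡⟨ cong (λ l → mult y l + r) (concat-++ ts ps′) ⟩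
  mult y (concat (ts ++ ps′)) + r                  ≡⟨ mult-++ y (concat (ts ++ ps′)) _ ⟨
  mult y (concat (ts ++ ps′) ++ concatMap toList (proj₂ (promote b cs))) ∎
  where
  ts = proj₁ (promote b cs)
  ps′ = proj₂ (peelAll b ps)
  a = mult y (concat ps′)
  t = mult y (concat ts)
  r = mult y (concatMap toList (proj₂ (promote b cs)))

module _ {T b : ℕ} where

  mult-removeMinᴸ : ∀ ps cs → All (Chain 1 b T) ps → Columns 1 0 b T cs →
    mult b (entriesᴾ (ps , cs)) ≡ countTrue (proj₁ (peelAll b ps)) + length (proj₁ (promote b cs))
  mult-removeMinᴸ ps cs chains columns =
    trans (mult-++ b (concat ps) _) (cong₂ _+_ (mult-peelAll ps chains) (mult-promote cs columns))

  removeMinᴸ-insertMinᴸ : ∀ {p} j bs ps cs →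
    length bs ≡ p → length ps ≡ j + p → All (Chain 1 (suc b) T) ps → Columns 1 0 (suc b) T cs →
    removeMinᴸ b (insertMinᴸ b (j , bs , (ps , cs))) ≡ (j , bs , (ps , cs))
  removeMinᴸ-insertMinᴸ {p} j bs ps cs lb lp chains columns = begin
    assembleᴸ (promote b (demote b (take j ps) cs)) (peelAll b (unpeelAll b bs (drop j ps)))
      ≡⟨ cong₂ assembleᴸ (promote-demote (take j ps) cs columns)
                         (peelAll-unpeelAll bs (drop j ps) (trans lb (sym (length-drop-+ j ps lp))) (drop⁺ j chains)) ⟩
    (length (take j ps) , bs , (take j ps ++ drop j ps , cs))
      ≡⟨ cong₂ (λ j′ ps′ → j′ , bs , (ps′ , cs)) length-take-j (take++drop≡id j ps) ⟩
    (j , bs , (ps , cs)) ∎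
    where
    length-take-j : length (take j ps) ≡ j
    length-take-j = trans (length-take j ps) (trans (cong (j ⊓_) lp) (m≤n⇒m⊓n≡m (m≤m+n j p)))

  removeMinᴸ-valid : ∀ {p m ms} o → IsPartial 1 0 T b p (m ∷ ms) o → IsLpsStep T b p m ms (removeMinᴸ b o)
  removeMinᴸ-valid {p} {m} {ms} (ps , cs) (lp , chains , columns , mult-b≡m , counts) =
    subst (j ≤_) total≡m (m≤n+m j ones) ,
    (trans (length-map _ ps) lp , trans (sym (m+n∸n≡m ones j)) (cong (_∸ j) total≡m)) ,
    trans (length-++ ts) (cong (j +_) (trans (length-map _ ps) lp)) ,
    ++⁺ (proj₁ promoted) (peelAll-Chain chains) ,
    proj₂ promoted ,
    HasCountsFrom-cong (suc b) ms (λ x b<x → mult-removeMinᴸ-other b (>⇒≢ b<x) (ps , cs)) counts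
    where
    ts = proj₁ (promote b cs)
    j = length ts
    ones = countTrue (proj₁ (peelAll b ps))
    promoted : All (Chain 1 (suc b) T) ts × Columns 1 0 (suc b) T (proj₂ (promote b cs))
    promoted = promote-valid cs columns
    total≡m : ones + j ≡ m
    total≡m = trans (sym (mult-removeMinᴸ ps cs chains columns)) mult-b≡m

  insertMinᴸ-valid : b < T → ∀ {p m ms} y → IsLpsStep T b p m ms y → IsPartial 1 0 T b p (m ∷ ms) (insertMinᴸ b y)
  insertMinᴸ-valid b<T {p} {m} {ms} y@(j , bs , (ps , cs)) (j≤m , (lb , ones≡) , lp , chains , columns , counts) =
    trans (length-unpeelAll b bs (drop j ps) (trans lb (sym (length-drop-+ j ps lp)))) lb ,
    chains′ , columns′ ,
    (begin
      mult b (entriesᴾ o)                                                      ≡⟨ mult-removeMinᴸ ps′ cs′ chains′ columns′ ⟩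
      countTrue (proj₁ (peelAll b ps′)) + length (proj₁ (promote b cs′))       ≡⟨ cong (λ (j , bs , _) → countTrue bs + j) round-trip ⟩
      countTrue bs + j                                                          ≡⟨ cong (_+ j) ones≡ ⟩
      (m ∸ j) + j                                                              ≡⟨ m∸n+n≡m j≤m ⟩
      m                                                                        ∎) ,
    HasCountsFrom-cong (suc b) ms
      (λ x b<x → sym (trans (mult-removeMinᴸ-other b (>⇒≢ b<x) o) (cong (λ (_ , _ , o) → mult x (entriesᴾ o)) round-trip)))
      counts
    where
    o = insertMinᴸ b y
    ps′ = proj₁ o
    cs′ = proj₂ o
    chains′ : All (Chain 1 b T) ps′
    chains′ = unpeelAll-Chain b<T bs (drop⁺ j chains)
    columns′ : Columns 1 0 b T cs′
    columns′ = demote-valid b<T (take⁺ j chains) columns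
    round-trip : removeMinᴸ b o ≡ y
    round-trip = removeMinᴸ-insertMinᴸ j bs ps cs lb lp chains columns

IsLpsStep-irrelevant : ∀ T b p m ms y → Irrelevant (IsLpsStep T b p m ms y)
IsLpsStep-irrelevant T b p m ms (j , bs , o) =
  ×-irrelevant ≤-irrelevant (×-irrelevant (HasOnes-irrelevant p (m ∸ j) bs) (IsPartial-irrelevant 1 0 T (suc b) (j + p) ms o))

removeMinᴸ-↔ : ∀ {T b p m ms} → b < T →
  Partial 1 0 T b p (m ∷ ms) ↔ Σ (Σ ℕ (_≤ m)) (λ (j , _) → BitVec p (m ∸ j) × Partial 1 0 T (suc b) (j + p) ms)
removeMinᴸ-↔ {T} {b} {p} {m} {ms} b<T = ↔-begin
  Partial 1 0 T b p (m ∷ ms)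
    ↔⟨ subtype-↔ (IsPartial-irrelevant 1 0 T b p (m ∷ ms)) (IsLpsStep-irrelevant T b p m ms)
         (λ o _ → removeMinᴸ b o) (λ y _ → insertMinᴸ b y)
         removeMinᴸ-valid (insertMinᴸ-valid b<T)
         (λ o _ _ → insertMinᴸ-removeMinᴸ b o)
         (λ { (j , bs , (ps , cs)) (_ , (lb , _) , lp , chains , columns , _) _ →
              removeMinᴸ-insertMinᴸ j bs ps cs lb lp chains columns }) ⟩
  Σ LpsStep (IsLpsStep T b p m ms)
    ↔⟨ mk↔ₛ′ (λ ((j , bs , o) , (j≤m , ones , valid)) → (j , j≤m) , (bs , ones) , (o , valid))
             (λ ((j , j≤m) , (bs , ones) , (o , valid)) → (j , bs , o) , (j≤m , ones , valid))
             (λ _ → refl) (λ _ → refl) ⟩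
  Σ (Σ ℕ (_≤ m)) (λ (j , _) → BitVec p (m ∸ j) × Partial 1 0 T (suc b) (j + p) ms)
    ↔-∎

lpsCount : ℕ → List ℕ → ℕ
lpsCount p [] = 1
lpsCount p (m ∷ ms) = sumL p m (λ j → lpsCount (p + j) ms)

Partial↔lpsCount : ∀ ms {T b p} → T ≡ b + length ms → Partial 1 0 T b p ms ↔ Fin (lpsCount p ms)
Partial↔lpsCount [] {b = b} {p} refl rewrite +-identityʳ b = Partial-exhausted↔Fin1 1 0 b p
Partial↔lpsCount (m ∷ ms) {T} {b} {p} T≡ = ↔-begin
  Partial 1 0 T b p (m ∷ ms)
    ↔⟨ removeMinᴸ-↔ (subst (b <_) (sym T≡) (m<m+n b (s≤s z≤n))) ⟩
  Σ (Σ ℕ (_≤ m)) (λ (j , _) → BitVec p (m ∸ j) × Partial 1 0 T (suc b) (j + p) ms)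
    ↔⟨ Σ≤↔∑≤ m _ _ (λ j → ×↔Fin* (BitVec↔C p (m ∸ j)) (rest j)) ⟩
  Fin (lpsCount p (m ∷ ms))
    ↔-∎
  where
  rest : ∀ j → Partial 1 0 T (suc b) (j + p) ms ↔ Fin (lpsCount (p + j) ms)
  rest j = ↔-begin
    Partial 1 0 T (suc b) (j + p) ms  ↔⟨ Partial↔lpsCount ms (trans T≡ (+-suc b (length ms))) ⟩
    Fin (lpsCount (j + p) ms)         ↔⟨ ≡⇒Fin↔ (cong (λ q → lpsCount q ms) (+-comm j p)) ⟩
    Fin (lpsCount (p + j) ms)         ↔-∎

-- Removing the least symbol from an rps filling

strip : ℕ → List ℕ → ℕ × List ℕ
strip b [] = 0 , []
strip b (x ∷ xs) with x ≟ b
... | yes _ = map₁ suc (strip b xs)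
... | no _ = 0 , x ∷ xs

unstrip : ℕ → ℕ → List ℕ → List ℕ
unstrip b c l = replicate c b ++ l

stripAll : ℕ → List (List ℕ) → List ℕ × List (List ℕ)
stripAll b ps = map (proj₁ ∘ strip b) ps , map (proj₂ ∘ strip b) ps

unstripAll : ℕ → List ℕ → List (List ℕ) → List (List ℕ)
unstripAll b = zipWith (unstrip b)

unstrip-strip : ∀ b l → unstrip b (proj₁ (strip b l)) (proj₂ (strip b l)) ≡ l
unstrip-strip b [] = refl
unstrip-strip b (x ∷ xs) with x ≟ b
... | yes refl = cong (b ∷_) (unstrip-strip b xs)
... | no _ = refl

unstripAll-stripAll : ∀ b ps → unstripAll b (proj₁ (stripAll b ps)) (proj₂ (stripAll b ps)) ≡ ps
unstripAll-stripAll b [] = refl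
unstripAll-stripAll b (l ∷ ps) = cong₂ _∷_ (unstrip-strip b l) (unstripAll-stripAll b ps)

length-unstripAll : ∀ b cs ps → length cs ≡ length ps → length (unstripAll b cs ps) ≡ length ps
length-unstripAll b [] [] _ = refl
length-unstripAll b (_ ∷ cs) (_ ∷ ps) eq = cong suc (length-unstripAll b cs ps (suc-injective eq))

mult-strip-other : ∀ {y b} → y ≢ b → ∀ l → mult y l ≡ mult y (proj₂ (strip b l))
mult-strip-other y≢b [] = refl
mult-strip-other {y} {b} y≢b (x ∷ xs) with x ≟ b
... | yes refl = trans (mult-there xs y≢b) (mult-strip-other y≢b xs)
... | no _ = refl

mult-stripAll-other : ∀ {y b} → y ≢ b → ∀ ps → mult y (concat ps) ≡ mult y (concat (proj₂ (stripAll b ps)))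
mult-stripAll-other y≢b [] = refl
mult-stripAll-other {y} {b} y≢b (l ∷ ps) = begin
  mult y (l ++ concat ps)                                               ≡⟨ mult-++ y l (concat ps) ⟩
  mult y l + mult y (concat ps)                                         ≡⟨ cong₂ _+_ (mult-strip-other y≢b l) (mult-stripAll-other y≢b ps) ⟩
  mult y (proj₂ (strip b l)) + mult y (concat (proj₂ (stripAll b ps)))  ≡⟨ mult-++ y (proj₂ (strip b l)) _ ⟨
  mult y (concat (proj₂ (stripAll b (l ∷ ps))))                         ∎

module _ {T b : ℕ} where

  strip-unstrip : ∀ c l → Chain 0 (suc b) T l → strip b (unstrip b c l) ≡ (c , l)
  strip-unstrip (suc c) l chain rewrite ≟-diag (refl {x = b}) = cong (map₁ suc) (strip-unstrip c l chain)
  strip-unstrip zero [] _ = refl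
  strip-unstrip zero (x ∷ xs) (b<x , _) with x ≟ b
  ... | yes refl = ⊥-elim (<-irrefl refl b<x)
  ... | no _ = refl

  stripAll-unstripAll : ∀ cs ps → length cs ≡ length ps → All (Chain 0 (suc b) T) ps →
    stripAll b (unstripAll b cs ps) ≡ (cs , ps)
  stripAll-unstripAll [] [] _ _ = refl
  stripAll-unstripAll (c ∷ cs) (l ∷ ps) eq (chain ∷ chains) =
    cong₂ (λ (c , l) (cs , ps) → c ∷ cs , l ∷ ps)
      (strip-unstrip c l chain) (stripAll-unstripAll cs ps (suc-injective eq) chains)

  strip-Chain : ∀ l → Chain 0 b T l → Chain 0 (suc b) T (proj₂ (strip b l))
  strip-Chain [] _ = tt
  strip-Chain (x ∷ xs) (b≤x , x<T , rest) with x ≟ b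
  ... | yes refl = strip-Chain xs rest
  ... | no x≢b = ≤∧≢⇒< b≤x (≢-sym x≢b) , x<T , rest

  stripAll-Chain : ∀ {ps} → All (Chain 0 b T) ps → All (Chain 0 (suc b) T) (proj₂ (stripAll b ps))
  stripAll-Chain [] = []
  stripAll-Chain {l ∷ _} (chain ∷ chains) = strip-Chain l chain ∷ stripAll-Chain chains

  unstrip-Chain : b < T → ∀ c l → Chain 0 (suc b) T l → Chain 0 b T (unstrip b c l)
  unstrip-Chain b<T zero l chain = Chain-weaken l (n≤1+n b) chain
  unstrip-Chain b<T (suc c) l chain = ≤-refl , b<T , unstrip-Chain b<T c l chain

  unstripAll-Chain : b < T → ∀ cs {ps} → All (Chain 0 (suc b) T) ps → All (Chain 0 b T) (unstripAll b cs ps)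
  unstripAll-Chain b<T [] _ = []
  unstripAll-Chain b<T (_ ∷ _) [] = []
  unstripAll-Chain b<T (c ∷ cs) {l ∷ _} (chain ∷ chains) = unstrip-Chain b<T c l chain ∷ unstripAll-Chain b<T cs chains

  mult-strip : ∀ l → Chain 0 b T l → mult b l ≡ proj₁ (strip b l)
  mult-strip [] _ = refl
  mult-strip (x ∷ xs) (b≤x , x<T , rest) with x ≟ b
  ... | yes refl = trans (mult-here b xs) (cong suc (mult-strip xs rest))
  ... | no x≢b = mult-Chain-below (x ∷ xs) ≤-refl (≤∧≢⇒< b≤x (≢-sym x≢b) , x<T , rest)

  mult-stripAll : ∀ ps → All (Chain 0 b T) ps → mult b (concat ps) ≡ sum (proj₁ (stripAll b ps))
  mult-stripAll [] [] = refl
  mult-stripAll (l ∷ ps) (chain ∷ chains) =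
    trans (mult-++ b l (concat ps)) (cong₂ _+_ (mult-strip l chain) (mult-stripAll ps chains))

RpsStep : Set
RpsStep = (List ℕ × PartialFilling) ⊎ (List ℕ × PartialFilling)

countsOf : RpsStep → List ℕ
countsOf (inj₁ (cnts , _)) = cnts
countsOf (inj₂ (cnts , _)) = cnts

remainderOf : RpsStep → PartialFilling
remainderOf (inj₁ (_ , o)) = o
remainderOf (inj₂ (_ , o)) = o

IsShaped : ℕ → ℕ → ℕ → ℕ → ℕ → PartialFilling → Set
IsShaped gc gr T b p (ps , cs) = length ps ≡ p × All (Chain gc b T) ps × Columns gc gr b T cs

StepShapeᴿ : ℕ → ℕ → ℕ → RpsStep → Set
StepShapeᴿ T b k (inj₁ (cnts , o)) = length cnts ≡ k × IsShaped 0 1 T (suc b) k o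
StepShapeᴿ T b k (inj₂ (cnts , o)) = (length cnts ≡ suc k × HeadPositive cnts) × IsShaped 0 1 T (suc b) (suc k) o

IsRpsStep : ℕ → ℕ → ℕ → ℕ → List ℕ → RpsStep → Set
IsRpsStep T b k m ms y =
  StepShapeᴿ T b k y × sum (countsOf y) ≡ m × HasCountsFrom (suc b) ms (λ x → mult x (entriesᴾ (remainderOf y)))

-- The least symbol b of an rps partial filling fills an initial segment of each
-- open column, and only the first closed column can have bottom b; that column
-- becomes the first open column.
removeClosed : ℕ → List (List⁺ ℕ) → List ℕ × List (List ℕ) → RpsStep
removeClosed b [] (cnts , ps) = inj₁ (cnts , (ps , []))
removeClosed b ((x ∷ xs) ∷ cs) (cnts , ps) with x ≟ b
... | yes _ = inj₂ (suc (proj₁ (strip b xs)) ∷ cnts , (proj₂ (strip b xs) ∷ ps , cs))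
... | no _ = inj₁ (cnts , (ps , (x ∷ xs) ∷ cs))

removeMinᴿ : ℕ → PartialFilling → RpsStep
removeMinᴿ b (ps , cs) = removeClosed b cs (stripAll b ps)

insertMinᴿ : ℕ → RpsStep → PartialFilling
insertMinᴿ b (inj₁ (cnts , (ps , cs))) = unstripAll b cnts ps , cs
insertMinᴿ b (inj₂ (suc c ∷ cnts , (r ∷ ps , cs))) = unstripAll b cnts ps , (b ∷ unstrip b c r) ∷ cs
insertMinᴿ b (inj₂ _) = [] , []  -- unreachable under StepShapeᴿ

insertMinᴿ-removeMinᴿ : ∀ b o → insertMinᴿ b (removeMinᴿ b o) ≡ o
insertMinᴿ-removeMinᴿ b (ps , []) = cong (_, []) (unstripAll-stripAll b ps)
insertMinᴿ-removeMinᴿ b (ps , (x ∷ xs) ∷ cs) with x ≟ b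
... | yes refl = cong₂ _,_ (unstripAll-stripAll b ps) (cong (λ l → (b ∷ l) ∷ cs) (unstrip-strip b xs))
... | no _ = cong (_, (x ∷ xs) ∷ cs) (unstripAll-stripAll b ps)

mult-removeMinᴿ-other : ∀ {y} b → y ≢ b → ∀ o →
  mult y (entriesᴾ o) ≡ mult y (entriesᴾ (remainderOf (removeMinᴿ b o)))
mult-removeMinᴿ-other {y} b y≢b (ps , cs) =
  trans (mult-++ y (concat ps) _)
  (trans (cong (_+ mult y (concatMap toList cs)) (mult-stripAll-other y≢b ps))
  (trans (sym (mult-++ y (concat (proj₂ (stripAll b ps))) _)) (closed cs (stripAll b ps))))
  where
  closed : ∀ cs q → mult y (entriesᴾ (proj₂ q , cs)) ≡ mult y (entriesᴾ (remainderOf (removeClosed b cs q)))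
  closed [] _ = refl
  closed ((x ∷ xs) ∷ cs) (_ , ps) with x ≟ b
  ... | no _ = refl
  ... | yes refl = begin
    mult y (concat ps ++ (b ∷ xs) ++ rest)     ≡⟨ mult-++ y (concat ps) _ ⟩
    a + mult y ((b ∷ xs) ++ rest)              ≡⟨ cong (a +_) (mult-there (xs ++ rest) y≢b) ⟩
    a + mult y (xs ++ rest)                    ≡⟨ cong (a +_) (mult-++ y xs rest) ⟩
    a + (mult y xs + e)                        ≡⟨ cong (λ s → a + (s + e)) (mult-strip-other y≢b xs) ⟩
    a + (s + e)                                ≡⟨ +-assoc a s e ⟨
    (a + s) + e                                ≡⟨ cong (_+ e) (+-comm a s) ⟩
    (s + a) + e                                ≡⟨ cong (_+ e) (mult-++ y r (concat ps)) ⟨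
    mult y (r ++ concat ps) + e                ≡⟨ mult-++ y (r ++ concat ps) rest ⟨
    mult y ((r ++ concat ps) ++ rest)          ∎
    where
    rest = concatMap toList cs
    r = proj₂ (strip b xs)
    a = mult y (concat ps)
    s = mult y r
    e = mult y rest

module _ {T b : ℕ} where

  mult-removeMinᴿ : ∀ ps cs → All (Chain 0 b T) ps → Columns 0 1 b T cs →
    mult b (entriesᴾ (ps , cs)) ≡ sum (countsOf (removeMinᴿ b (ps , cs)))
  mult-removeMinᴿ ps cs chains columns =
    trans (mult-++ b (concat ps) _) (trans (cong (_+ _) (mult-stripAll ps chains)) (closed cs (stripAll b ps) columns))
    where
    closed : ∀ cs q → Columns 0 1 b T cs → sum (proj₁ q) + mult b (concatMap toList cs) ≡ sum (countsOf (removeClosed b cs q))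
    closed [] (cnts , _) _ = +-identityʳ (sum cnts)
    closed ((x ∷ xs) ∷ cs) (cnts , _) ((b≤x , x<T , chain) , rest) with x ≟ b
    ... | no x≢b = trans
      (cong (sum cnts +_) (mult-Columns-below ((x ∷ xs) ∷ cs) ≤-refl ((≤∧≢⇒< b≤x (≢-sym x≢b) , x<T , chain) , rest)))
      (+-identityʳ (sum cnts))
    ... | yes refl = begin
      sum cnts + mult b ((b ∷ xs) ++ concatMap toList cs)         ≡⟨ cong (sum cnts +_) (mult-here b (xs ++ _)) ⟩
      sum cnts + suc (mult b (xs ++ concatMap toList cs))         ≡⟨ cong (λ n → sum cnts + suc n) (mult-++ b xs _) ⟩
      sum cnts + suc (mult b xs + mult b (concatMap toList cs))   ≡⟨ cong₂ (λ u v → sum cnts + suc (u + v)) (mult-strip xs chain) (mult-Columns-below cs ≤-refl rest) ⟩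
      sum cnts + suc (proj₁ (strip b xs) + 0)                     ≡⟨ cong (λ n → sum cnts + suc n) (+-identityʳ _) ⟩
      sum cnts + suc (proj₁ (strip b xs))                         ≡⟨ +-comm (sum cnts) _ ⟩
      suc (proj₁ (strip b xs)) + sum cnts                         ∎

  removeMinᴿ-shape : ∀ {k} o → IsShaped 0 1 T b k o → StepShapeᴿ T b k (removeMinᴿ b o)
  removeMinᴿ-shape {k} (ps , cs) (lp , chains , columns) = closed cs columns
    where
    lengths : ∀ {A : Set} {f : List ℕ → A} → length (map f ps) ≡ k
    lengths = trans (length-map _ ps) lp
    closed : ∀ cs → Columns 0 1 b T cs → StepShapeᴿ T b _ (removeClosed b cs (stripAll b ps))
    closed [] _ = lengths , lengths , stripAll-Chain chains , _
    closed ((x ∷ xs) ∷ cs) ((b≤x , x<T , chain) , rest) with x ≟ b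
    ... | yes refl = (cong suc lengths , s≤s z≤n) , cong suc lengths , strip-Chain xs chain ∷ stripAll-Chain chains , rest
    ... | no x≢b = lengths , lengths , stripAll-Chain chains , (≤∧≢⇒< b≤x (≢-sym x≢b) , x<T , chain) , rest

  removeMinᴿ-insertMinᴿ : ∀ {k} y → StepShapeᴿ T b k y → removeMinᴿ b (insertMinᴿ b y) ≡ y
  removeMinᴿ-insertMinᴿ (inj₁ (cnts , (ps , []))) (lc , lp , chains , _) =
    cong (λ (cnts , ps) → inj₁ (cnts , (ps , []))) (stripAll-unstripAll cnts ps (trans lc (sym lp)) chains)
  removeMinᴿ-insertMinᴿ (inj₁ (cnts , (ps , (x ∷ xs) ∷ cs))) (lc , lp , chains , (b<x , _) , _) with x ≟ b
  ... | yes refl = ⊥-elim (<-irrefl refl b<x)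
  ... | no _ = cong (λ (cnts , ps) → inj₁ (cnts , (ps , (x ∷ xs) ∷ cs))) (stripAll-unstripAll cnts ps (trans lc (sym lp)) chains)
  removeMinᴿ-insertMinᴿ (inj₂ ([] , _)) ((_ , ()) , _)
  removeMinᴿ-insertMinᴿ (inj₂ (zero ∷ _ , _)) ((_ , ()) , _)
  removeMinᴿ-insertMinᴿ (inj₂ (suc _ ∷ _ , ([] , _))) (_ , () , _)
  removeMinᴿ-insertMinᴿ (inj₂ (suc c ∷ cnts , (r ∷ ps , cs))) ((lc , _) , lp , chain ∷ chains , _)
    rewrite ≟-diag (refl {x = b}) =
    cong₂ (λ (c , r) (cnts , ps) → inj₂ (suc c ∷ cnts , (r ∷ ps , cs)))
      (strip-unstrip c r chain) (stripAll-unstripAll cnts ps (suc-injective (trans lc (sym lp))) chains)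

  insertMinᴿ-shape : b < T → ∀ {k} y → StepShapeᴿ T b k y → IsShaped 0 1 T b k (insertMinᴿ b y)
  insertMinᴿ-shape b<T (inj₁ (cnts , (ps , cs))) (lc , lp , chains , columns) =
    trans (length-unstripAll b cnts ps (trans lc (sym lp))) lp ,
    unstripAll-Chain b<T cnts chains , Columns-weaken cs (n≤1+n b) columns
  insertMinᴿ-shape b<T (inj₂ ([] , _)) ((_ , ()) , _)
  insertMinᴿ-shape b<T (inj₂ (zero ∷ _ , _)) ((_ , ()) , _)
  insertMinᴿ-shape b<T (inj₂ (suc _ ∷ _ , ([] , _))) (_ , () , _)
  insertMinᴿ-shape b<T (inj₂ (suc c ∷ cnts , (r ∷ ps , cs))) ((lc , _) , lp , chain ∷ chains , columns) =
    trans (length-unstripAll b cnts ps (suc-injective (trans lc (sym lp)))) (suc-injective lp) ,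
    unstripAll-Chain b<T cnts chains ,
    (≤-refl , b<T , unstrip-Chain b<T c r chain) , columns

  removeMinᴿ-valid : ∀ {k m ms} o → IsPartial 0 1 T b k (m ∷ ms) o → IsRpsStep T b k m ms (removeMinᴿ b o)
  removeMinᴿ-valid {ms = ms} (ps , cs) (lp , chains , columns , mult-b≡m , counts) =
    removeMinᴿ-shape (ps , cs) (lp , chains , columns) ,
    trans (sym (mult-removeMinᴿ ps cs chains columns)) mult-b≡m ,
    HasCountsFrom-cong (suc b) ms (λ x b<x → mult-removeMinᴿ-other b (>⇒≢ b<x) (ps , cs)) counts

  insertMinᴿ-valid : b < T → ∀ {k m ms} y → IsRpsStep T b k m ms y → IsPartial 0 1 T b k (m ∷ ms) (insertMinᴿ b y)
  insertMinᴿ-valid b<T {ms = ms} y (shape , sum≡m , counts)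
    with lp , chains , columns ← insertMinᴿ-shape b<T y shape =
    lp , chains , columns ,
    trans (mult-removeMinᴿ _ _ chains columns) (trans (cong (sum ∘ countsOf) round-trip) sum≡m) ,
    HasCountsFrom-cong (suc b) ms
      (λ x b<x → sym (trans (mult-removeMinᴿ-other b (>⇒≢ b<x) (insertMinᴿ b y))
                            (cong (λ y → mult x (entriesᴾ (remainderOf y))) round-trip)))
      counts
    where
    round-trip : removeMinᴿ b (insertMinᴿ b y) ≡ y
    round-trip = removeMinᴿ-insertMinᴿ y shape

IsShaped-irrelevant : ∀ gc gr T b p o → Irrelevant (IsShaped gc gr T b p o)
IsShaped-irrelevant gc gr T b p (ps , cs) =
  ×-irrelevant ≡-irrelevant (×-irrelevant (All.irrelevant (Chain-irrelevant gc b T _)) (Columns-irrelevant gc gr b T cs))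

IsRpsStep-irrelevant : ∀ T b k m ms y → Irrelevant (IsRpsStep T b k m ms y)
IsRpsStep-irrelevant T b k m ms y =
  ×-irrelevant (shape y) (×-irrelevant ≡-irrelevant (HasCountsFrom-irrelevant (suc b) ms _))
  where
  shape : ∀ y → Irrelevant (StepShapeᴿ T b k y)
  shape (inj₁ (cnts , o)) = ×-irrelevant ≡-irrelevant (IsShaped-irrelevant 0 1 T (suc b) k o)
  shape (inj₂ ([] , o)) = λ { ((_ , ()) , _) }
  shape (inj₂ (c ∷ cnts , o)) = ×-irrelevant (×-irrelevant ≡-irrelevant ≤-irrelevant) (IsShaped-irrelevant 0 1 T (suc b) (suc k) o)

removeMinᴿ-↔ : ∀ {T b k m ms} → b < T →
  Partial 0 1 T b k (m ∷ ms) ↔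
  ((Composition k m × Partial 0 1 T (suc b) k ms) ⊎ (PositiveComposition k m × Partial 0 1 T (suc b) (suc k) ms))
removeMinᴿ-↔ {T} {b} {k} {m} {ms} b<T = ↔-begin
  Partial 0 1 T b k (m ∷ ms)
    ↔⟨ subtype-↔ (IsPartial-irrelevant 0 1 T b k (m ∷ ms)) (IsRpsStep-irrelevant T b k m ms)
         (λ o _ → removeMinᴿ b o) (λ y _ → insertMinᴿ b y)
         removeMinᴿ-valid (insertMinᴿ-valid b<T)
         (λ o _ _ → insertMinᴿ-removeMinᴿ b o)
         (λ y (shape , _) _ → removeMinᴿ-insertMinᴿ y shape) ⟩
  Σ RpsStep (IsRpsStep T b k m ms)
    ↔⟨ mk↔ₛ′
         (λ { (inj₁ (cnts , o) , (lc , lp , ch , co) , sum≡ , counts) → inj₁ ((cnts , lc , sum≡) , o , lp , ch , co , counts)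
            ; (inj₂ (cnts , o) , ((lc , pos) , lp , ch , co) , sum≡ , counts) → inj₂ ((cnts , (lc , sum≡) , pos) , o , lp , ch , co , counts) })
         (λ { (inj₁ ((cnts , lc , sum≡) , o , lp , ch , co , counts)) → inj₁ (cnts , o) , (lc , lp , ch , co) , sum≡ , counts
            ; (inj₂ ((cnts , (lc , sum≡) , pos) , o , lp , ch , co , counts)) → inj₂ (cnts , o) , ((lc , pos) , lp , ch , co) , sum≡ , counts })
         (λ { (inj₁ _) → refl ; (inj₂ _) → refl })
         (λ { (inj₁ _ , _) → refl ; (inj₂ _ , _) → refl }) ⟩
  ((Composition k m × Partial 0 1 T (suc b) k ms) ⊎ (PositiveComposition k m × Partial 0 1 T (suc b) (suc k) ms))
    ↔-∎

rpsCount : ℕ → List ℕ → ℕ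
rpsCount k [] = 1
rpsCount k (m ∷ ms) = compositions k m * rpsCount k ms + positiveCompositions k m * rpsCount (suc k) ms

Partial↔rpsCount : ∀ ms {T b k} → T ≡ b + length ms → Partial 0 1 T b k ms ↔ Fin (rpsCount k ms)
Partial↔rpsCount [] {b = b} {k} refl rewrite +-identityʳ b = Partial-exhausted↔Fin1 0 1 b k
Partial↔rpsCount (m ∷ ms) {T} {b} {k} T≡ = ↔-begin
  Partial 0 1 T b k (m ∷ ms)
    ↔⟨ removeMinᴿ-↔ (subst (b <_) (sym T≡) (m<m+n b (s≤s z≤n))) ⟩
  ((Composition k m × Partial 0 1 T (suc b) k ms) ⊎ (PositiveComposition k m × Partial 0 1 T (suc b) (suc k) ms))
    ↔⟨ ⊎↔Fin+ (×↔Fin* (Composition↔compositions k m) (Partial↔rpsCount ms T≡′))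
              (×↔Fin* (PositiveComposition↔positiveCompositions k m) (Partial↔rpsCount ms T≡′)) ⟩
  Fin (rpsCount k (m ∷ ms))
    ↔-∎
  where
  T≡′ : T ≡ suc b + length ms
  T≡′ = trans T≡ (+-suc b (length ms))

-- The recursions

sumL-cong : ∀ p m {f g : ℕ → ℕ} → (∀ j → f j ≡ g j) → sumL p m f ≡ sumL p m g
sumL-cong p m eq = ∑≤-cong m (λ j → cong ((p C (m ∸ j)) *_) (eq j))

sumL-zero : ∀ m f → sumL 0 m f ≡ f m
sumL-zero zero f = trans (+-identityʳ (f 0 + 0)) (+-identityʳ (f 0))
sumL-zero (suc m) f = trans (∑≤-suc m (λ j → (0 C (suc m ∸ j)) * f j)) (sumL-zero m (f ∘ suc))

lpsCount₀-∷ : ∀ m ms → lpsCount 0 (m ∷ ms) ≡ lpsCount m ms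
lpsCount₀-∷ m ms = sumL-zero m (λ j → lpsCount j ms)

rpsCount₀-∷ : ∀ {m} ms → 0 < m → rpsCount 0 (m ∷ ms) ≡ rpsCount 1 ms
rpsCount₀-∷ {suc m} ms _ = trans (cong (_* rpsCount 1 ms) (compositions[1,m]≡1 m)) (*-identityˡ (rpsCount 1 ms))

rpsCount-singleton : ∀ m → rpsCount 0 (m ∷ []) ≡ 1
rpsCount-singleton zero = refl
rpsCount-singleton (suc m) = rpsCount₀-∷ {suc m} [] (s≤s z≤n)

rpsCount₁-∷ : ∀ m ms → rpsCount 1 (m ∷ ms) ≡ rpsCount 1 ms + m * rpsCount 2 ms
rpsCount₁-∷ m ms = cong₂ _+_
  (trans (cong (_* rpsCount 1 ms) (compositions[1,m]≡1 m)) (*-identityˡ (rpsCount 1 ms)))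
  (cong (_* rpsCount 2 ms) (positiveCompositions[1,m]≡m m))

sum-map-*ˡ : ∀ {A : Set} c (f : A → ℕ) xs → sum (map (λ x → c * f x) xs) ≡ c * sum (map f xs)
sum-map-*ˡ c f [] = sym (*-zeroʳ c)
sum-map-*ˡ c f (x ∷ xs) = trans (cong (c * f x +_) (sum-map-*ˡ c f xs)) (sym (*-distribˡ-+ c (f x) _))

sum-bits-suc : ∀ (f : List ℕ → ℕ) k →
  sum (map f (bits (suc k))) ≡ sum (map (f ∘ (0 ∷_)) (bits k)) + sum (map (f ∘ (1 ∷_)) (bits k))
sum-bits-suc f k = go (bits k)
  where
  go : ∀ jss → sum (map f (concatMap (λ js → (0 ∷ js) ∷ (1 ∷ js) ∷ []) jss))
             ≡ sum (map (f ∘ (0 ∷_)) jss) + sum (map (f ∘ (1 ∷_)) jss)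
  go [] = refl
  go (js ∷ jss) = begin
    a + (b + sum (map f (concatMap _ jss)))  ≡⟨ cong (λ s → a + (b + s)) (go jss) ⟩
    a + (b + (A + B))                        ≡⟨ cong (a +_) (+-assoc b A B) ⟨
    a + ((b + A) + B)                        ≡⟨ cong (λ s → a + (s + B)) (+-comm b A) ⟩
    a + ((A + b) + B)                        ≡⟨ cong (a +_) (+-assoc A b B) ⟩
    a + (A + (b + B))                        ≡⟨ +-assoc a A _ ⟨
    (a + A) + (b + B)                        ∎
    where
    a = f (0 ∷ js)
    b = f (1 ∷ js)
    A = sum (map (f ∘ (0 ∷_)) jss)
    B = sum (map (f ∘ (1 ∷_)) jss)

-- Without positivity the claim fails at m = 0: prodR then has the factor C(1 + s, 0 ∸ 1) = 1.
rpsCount≡∑prodR : ∀ s ms → Positive ms → rpsCount (2 + s) ms ≡ sum (map (prodR s ms) (bits (length ms)))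
rpsCount≡∑prodR s [] _ = refl
rpsCount≡∑prodR s (suc n ∷ ms) (_ ∷ pos) = begin
  compositions (2 + s) (suc n) * rpsCount (2 + s) ms + compositions (3 + s) n * rpsCount (3 + s) ms
    ≡⟨ cong₂ _+_ (cong₂ _*_ binom₀ (rpsCount≡∑prodR s ms pos)) (cong₂ _*_ binom₁ (rpsCount≡∑prodR (suc s) ms pos)) ⟩
  c₀ * sum (map (prodR s ms) L) + c₁ * sum (map (prodR (suc s) ms) L)
    ≡⟨ cong₂ _+_ (sum-map-*ˡ c₀ (prodR s ms) L) (sum-map-*ˡ c₁ (prodR (suc s) ms) L) ⟨
  sum (map (λ js → c₀ * prodR s ms js) L) + sum (map (λ js → c₁ * prodR (suc s) ms js) L)
    ≡⟨ cong₂ _+_ (cong sum (map-cong (λ js → cong (λ t → c₀ * prodR t ms js) (sym (+-identityʳ s))) L))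
                 (cong sum (map-cong (λ js → cong (λ t → c₁ * prodR t ms js) (sym (+-comm s 1))) L)) ⟩
  sum (map (prodR s (suc n ∷ ms) ∘ (0 ∷_)) L) + sum (map (prodR s (suc n ∷ ms) ∘ (1 ∷_)) L)
    ≡⟨ sum-bits-suc (prodR s (suc n ∷ ms)) (length ms) ⟨
  sum (map (prodR s (suc n ∷ ms)) (bits (length (suc n ∷ ms)))) ∎
  where
  L = bits (length ms)
  c₀ = (suc n + 1 + s) C suc n
  c₁ = (suc n + 1 + s) C n
  binom₀ : compositions (2 + s) (suc n) ≡ c₀
  binom₀ = trans (compositions[1+k,m]≡[m+k]Cm (suc s) (suc n)) (cong (_C suc n) (sym (+-assoc (suc n) 1 s)))
  binom₁ : compositions (3 + s) n ≡ c₁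
  binom₁ = trans (compositions[1+k,m]≡[m+k]Cm (2 + s) n) (cong (_C n) (trans (+-suc n (suc s)) (cong suc (sym (+-assoc n 1 s)))))

lpsCount-recursion : ∀ m₁ m₂ rest →
  lpsCount 0 (m₁ ∷ m₂ ∷ rest) ≡ sumL m₁ m₂ (λ j → lpsCount 0 (m₁ + j ∷ rest))
lpsCount-recursion m₁ m₂ rest = trans (lpsCount₀-∷ m₁ (m₂ ∷ rest))
  (sumL-cong m₁ m₂ (λ j → sym (lpsCount₀-∷ (m₁ + j) rest)))

rpsCount-recursion : ∀ m₁ m₂ rest → Positive (m₁ ∷ m₂ ∷ rest) →
  rpsCount 0 (m₁ ∷ m₂ ∷ rest) ≡ rpsCount 0 (m₂ ∷ rest) + sumR m₂ rest
rpsCount-recursion m₁ m₂ rest (0<m₁ ∷ 0<m₂ ∷ pos) = begin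
  rpsCount 0 (m₁ ∷ m₂ ∷ rest)                               ≡⟨ rpsCount₀-∷ (m₂ ∷ rest) 0<m₁ ⟩
  rpsCount 1 (m₂ ∷ rest)                                    ≡⟨ rpsCount₁-∷ m₂ rest ⟩
  rpsCount 1 rest + m₂ * rpsCount 2 rest                    ≡⟨ cong₂ _+_ (sym (rpsCount₀-∷ rest 0<m₂)) (cong (m₂ *_) (rpsCount≡∑prodR 0 rest pos)) ⟩
  rpsCount 0 (m₂ ∷ rest) + m₂ * sum (map (prodR 0 rest) L)  ≡⟨ cong (rpsCount 0 (m₂ ∷ rest) +_) (sum-map-*ˡ m₂ (prodR 0 rest) L) ⟨
  rpsCount 0 (m₂ ∷ rest) + sumR m₂ rest                     ∎
  where L = bits (length rest)

rpsCount-pair : ∀ m k → 0 < m → rpsCount 0 (m ∷ k ∷ []) ≡ 1 + k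
rpsCount-pair m k 0<m = begin
  rpsCount 0 (m ∷ k ∷ [])  ≡⟨ rpsCount₀-∷ (k ∷ []) 0<m ⟩
  rpsCount 1 (k ∷ [])      ≡⟨ rpsCount₁-∷ k [] ⟩
  1 + k * 1                ≡⟨ cong suc (*-identityʳ k) ⟩
  1 + k                    ∎

LpsTab↔lpsCount : ∀ ms → LpsTab ms ↔ Fin (lpsCount 0 ms)
LpsTab↔lpsCount ms = ↔-trans (Tableau↔Partial 1 0 ms) (Partial↔lpsCount ms refl)

RpsTab↔rpsCount : ∀ ms → RpsTab ms ↔ Fin (rpsCount 0 ms)
RpsTab↔rpsCount ms = ↔-trans (Tableau↔Partial 0 1 ms) (Partial↔rpsCount ms refl)

proposition4p6 : Σ (List ℕ → ℕ) (λ L → Σ (List ℕ → ℕ) (λ R →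
    ((ms : List ℕ) → (LpsTab ms ↔ Fin (L ms)) × (RpsTab ms ↔ Fin (R ms)))
    × ((m : ℕ) → Positive (m ∷ []) → (L (m ∷ []) ≡ 1) × (R (m ∷ []) ≡ 1))
    × ((m k : ℕ) → Positive (m ∷ k ∷ []) → R (m ∷ k ∷ []) ≡ 1 + k)
    × ((m₁ m₂ : ℕ) (rest : List ℕ) → Positive (m₁ ∷ m₂ ∷ rest) →
        L (m₁ ∷ m₂ ∷ rest) ≡ sumL m₁ m₂ (λ j → L (m₁ + j ∷ rest)))
    × ((m₁ m₂ : ℕ) (rest : List ℕ) → Positive (m₁ ∷ m₂ ∷ rest) →
        R (m₁ ∷ m₂ ∷ rest) ≡ R (m₂ ∷ rest) + sumR m₂ rest)))
proposition4p6 =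
  lpsCount 0 , rpsCount 0 ,
  (λ ms → LpsTab↔lpsCount ms , RpsTab↔rpsCount ms) ,
  (λ m _ → lpsCount₀-∷ m [] , rpsCount-singleton m) ,
  (λ { m k (0<m ∷ _) → rpsCount-pair m k 0<m }) ,
  (λ m₁ m₂ rest _ → lpsCount-recursion m₁ m₂ rest) ,
  rpsCount-recursion
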